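{- Let $n\ge5$, let $D$ be an AUSO of the graph of the dual cyclic $4$-polytope $C^{*}(n)$, and for each $i$ let $q_i$ and $s_i$ denote the unique source and the unique sink of the $2$-face $F_i$. Let $i\in\{0,\dots,n-1\}$, $j=i+1\bmod n$. Let $\gamma^q_{i,j}$ be a directed path in $D$ joining $q_i$ and $q_j$ (in either direction) and let $\gamma^s_{i,j}$ be a directed path in $D$ joining $s_i$ and $s_j$ (in either direction). Then $\gamma^q_{i,j}$ and $\gamma^s_{i,j}$ have no vertex in common.
   Context: $C^{*}(n)$ denotes a simple $4$-polytope combinatorially dual to the cyclic polytope $C(n)=\operatorname{conv}\{(t,t^2,t^3,t^4)^T : t=0,\dots,n-1\}$, with facets $f_0,\dots,f_{n-1}$ ($f_t$ corresponding to the vertex $(t,t^2,t^3,t^4)$ of $C(n)$; four facets indexed by $S$ meet in a vertex iff $S$ satisfies Gale's evenness condition). $F_i$ denotes the $2$-face $f_i\cap f_{i+1\bmod n}$. Since $F_i$ and $F_{i+1\bmod n}$ together contain all vertices of the facet $f_{i+1\bmod n}$, whose unique source (resp. sink) is $q_i$ or $q_{i+1}$ (resp. $s_i$ or $s_{i+1}$), such directed paths exist. An AUSO of the graph of a polytope is an acyclic orientation such that every nonempty face induces a subgraph with a unique sink; on simple polytopes every face then also has a unique source. -}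

module Defs where

open import Data.Nat as ℕ using (ℕ; zero; suc)
open import Data.Nat.Divisibility using (_∣_)
open import Data.Fin as Fin using (Fin; toℕ; fromℕ<)
open import Data.Fin.Properties using (_<?_)
open import Data.Fin.Subset using (Subset; _∈_; _∉_; _⊆_; _∩_; _∪_; ⁅_⁆; ∣_∣)
open import Data.Fin.Subset.Properties using (_∈?_)
open import Data.List as List using (List; []; _∷_; filter; allFin; length)
open import Data.List.Membership.Propositional as LM using ()
open import Data.Product using (Σ; ∃; _×_; _,_)
open import Data.Sum using (_⊎_)
open import Data.Empty using (⊥)
open import Relation.Nullary using (¬_; yes; no)
open import Relation.Nullary.Decidable using (_×-dec_)
open import Relation.Binary.PropositionalEquality using (_≡_)

sucMod : ∀ {n} → Fin n → Fin n
sucMod {suc m} i with suc (toℕ i) ℕ.<? suc m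
... | yes p = fromℕ< p
... | no _  = Fin.zero

between : ∀ {n} → Subset n → Fin n → Fin n → ℕ
between {n} S a b =
  length (filter (λ k → (a <? k) ×-dec ((k <? b) ×-dec (k ∈? S))) (allFin n))

GaleEven : ∀ {n} → Subset n → Set
GaleEven {n} S = ∀ (a b : Fin n) → a Fin.< b → a ∉ S → b ∉ S → 2 ∣ between S a b

-- Vertices of C*(n): sets of 4 facets f_t meeting in a vertex, i.e. the
-- facets of C(n) (Gale evenness).  A vertex is identified with its facet set.
IsVertex : ∀ {n} → Subset n → Set
IsVertex S = ∣ S ∣ ≡ 4 × GaleEven S

-- C*(n) is simple, so two vertices are adjacent iff they share 3 facets.
Adj : ∀ {n} → Subset n → Subset n → Set
Adj u v = IsVertex u × IsVertex v × ∣ u ∩ v ∣ ≡ 3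

data Path {n} (D : Subset n → Subset n → Set) : Subset n → Subset n → Set where
  [_]    : ∀ v → Path D v v
  _∷⟨_⟩_ : ∀ u {v w} → D u v → Path D v w → Path D u w

verts : ∀ {n} {D : Subset n → Subset n → Set} {a b} → Path D a b → List (Subset n)
verts [ v ] = v ∷ []
verts (u ∷⟨ _ ⟩ p) = u ∷ verts p

JoinPath : ∀ {n} → (Subset n → Subset n → Set) → Subset n → Subset n → Set
JoinPath D a b = Path D a b ⊎ Path D b a

-- The face given by a set T of facets consists of the vertices containing T.
-- s is a sink (source) of the face T in D.
IsSinkOf : ∀ {n} → (Subset n → Subset n → Set) → Subset n → Subset n → Set
IsSinkOf D T s = IsVertex s × T ⊆ s × (∀ w → T ⊆ w → ¬ D s w)

IsSourceOf : ∀ {n} → (Subset n → Subset n → Set) → Subset n → Subset n → Set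
IsSourceOf D T s = IsVertex s × T ⊆ s × (∀ w → T ⊆ w → ¬ D w s)

NonemptyFace : ∀ {n} → Subset n → Set
NonemptyFace T = ∃ λ v → IsVertex v × T ⊆ v

record IsAUSO (n : ℕ) (D : Subset n → Subset n → Set) : Set where
  field
    arc⇒adj   : ∀ u v → D u v → Adj u v
    adj⇒arc   : ∀ u v → Adj u v → D u v ⊎ D v u
    antisym   : ∀ u v → D u v → D v u → ⊥
    acyclic   : ∀ u v → D u v → Path D v u → ⊥
    sinkExists : ∀ T → NonemptyFace T → ∃ λ s → IsSinkOf D T s
    sinkUnique : ∀ T s s′ → IsSinkOf D T s → IsSinkOf D T s′ → s ≡ s′

-- The 2-face F_i = f_i ∩ f_{i+1 mod n}.
F : ∀ {n} → Fin n → Subset n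
F i = ⁅ i ⁆ ∪ ⁅ sucMod i ⁆

joinVerts : ∀ {n} {D : Subset n → Subset n → Set} {a b} → JoinPath D a b → List (Subset n)
joinVerts (Data.Sum.inj₁ p) = verts p
joinVerts (Data.Sum.inj₂ p) = verts p

module Submission where

-- A vertex of C*(n) is a 4-set of facets satisfying Gale evenness, i.e. a union of two
-- disjoint cyclically consecutive pairs.  Hence the 2-face F_b = {b, b+1} is a polygon whose n − 2
-- corners are {b, b+1, b+t+2, b+t+3}, t ∈ ℤ/(n−2), consecutive ones being adjacent.  In an
-- acyclic orientation of a polygon with a unique sink every corner reaches the sink, and the source
-- reaches every corner: walk away from the source in both directions; if both walks stopped early,
-- the sink would occur twice on the polygon.
-- The faces F_i and F_{i+1} share the two corners {i−1, i, i+1, i+2} and {i, i+1, i+2, i+3}.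
-- A common vertex v of γ^q and γ^s gives a path s_c → v → q_b with b, c ∈ {i, i+1}; then every
-- shared corner x satisfies s_c → q_b → x → s_c, so x = s_c by acyclicity, which cannot hold for
-- both shared corners.

open import Data.Nat using (ℕ; zero; suc; _+_; _≤_; s≤s)
open import Data.Fin using (Fin)
open import Data.Fin.Subset using (Subset)
open import Data.Sum using (_⊎_)
open import Data.Empty using (⊥)
open import Relation.Binary.PropositionalEquality using (_≡_)
open import Defs

module Cyclic where

  open import Data.Nat as ℕ using (_∸_; _<_; z≤n; s≤s⁻¹; NonZero)
  open import Data.Nat.Properties
  open import Data.Nat.DivMod
  open import Data.Fin as Fin using (toℕ)
  open import Data.Fin.Properties using (toℕ-fromℕ<; toℕ-injective; toℕ<n)
  open import Data.Sum using (inj₁; inj₂)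
  open import Data.Empty using (⊥-elim)
  open import Data.Product using (∃-syntax; _×_; _,_)
  open import Relation.Nullary using (yes; no)
  open import Relation.Binary.PropositionalEquality

  -- The with-clauses of sucMod make its normal forms large, and type checking blows up when they
  -- get unfolded under nested applications; all reasoning therefore goes through this opaque
  -- copy, which is characterised by toℕ-next.
  opaque
    next : ∀ {m} → Fin (suc m) → Fin (suc m)
    next = sucMod

    next≡sucMod : ∀ {m} (x : Fin (suc m)) → next x ≡ sucMod x
    next≡sucMod x = refl

    toℕ-next : ∀ {m} (x : Fin (suc m)) →
               (toℕ x < m × toℕ (next x) ≡ suc (toℕ x)) ⊎ (toℕ x ≡ m × next x ≡ Fin.zero)
    toℕ-next {m} x with suc (toℕ x) ℕ.<? suc m
    ... | yes x+1<n = inj₁ (s≤s⁻¹ x+1<n , toℕ-fromℕ< x+1<n)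
    ... | no  x+1≮n = inj₂ (suc-injective (≤-antisym (toℕ<n x) (≮⇒≥ x+1≮n)) , refl)

  infixl 6 _⊕_
  _⊕_ : ∀ {m} → Fin (suc m) → ℕ → Fin (suc m)
  x ⊕ zero  = x
  x ⊕ suc o = next (x ⊕ o)

  prev : ∀ {m} → Fin (suc m) → Fin (suc m)
  prev {m} x = x ⊕ m

  next-last : ∀ {m} (x : Fin (suc m)) → toℕ x ≡ m → next x ≡ Fin.zero
  next-last x x≡m with toℕ-next x
  ... | inj₁ (x<m , _)  = ⊥-elim (<-irrefl x≡m x<m)
  ... | inj₂ (_ , x⁺≡0) = x⁺≡0

  toℕ-next-% : ∀ {m} (x : Fin (suc m)) → toℕ (next x) ≡ suc (toℕ x) % suc m
  toℕ-next-% {m} x with toℕ-next x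
  ... | inj₁ (x<m , x⁺≡x+1) = trans x⁺≡x+1 (sym (m<n⇒m%n≡m (s≤s x<m)))
  ... | inj₂ (x≡m , x⁺≡0)   = begin
    toℕ (next x)         ≡⟨ cong toℕ x⁺≡0 ⟩
    0                    ≡⟨ sym (n%n≡0 (suc m)) ⟩
    suc m % suc m        ≡⟨ cong (λ i → suc i % suc m) (sym x≡m) ⟩
    suc (toℕ x) % suc m  ∎
    where open ≡-Reasoning

  +%-absorbʳ : ∀ i j N .{{_ : NonZero N}} → (i + j % N) % N ≡ (i + j) % N
  +%-absorbʳ i j N = begin
    (i + j % N) % N          ≡⟨ %-distribˡ-+ i (j % N) N ⟩
    (i % N + j % N % N) % N  ≡⟨ cong (λ r → (i % N + r) % N) (m%n%n≡m%n j N) ⟩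
    (i % N + j % N) % N      ≡⟨ sym (%-distribˡ-+ i j N) ⟩
    (i + j) % N              ∎
    where open ≡-Reasoning

  +%-cancelˡ : ∀ a {o o′ N} .{{_ : NonZero N}} → a ≤ N → o < N → o′ < N →
               (a + o) % N ≡ (a + o′) % N → o ≡ o′
  +%-cancelˡ a {o} {o′} {N} a≤N o<N o′<N eq =
    trans (unshift o o<N) (trans (cong (λ r → (N ∸ a + r) % N) eq) (sym (unshift o′ o′<N)))
    where
    open ≡-Reasoning
    unshift : ∀ z → z < N → z ≡ (N ∸ a + (a + z) % N) % N
    unshift z z<N = sym (begin
      (N ∸ a + (a + z) % N) % N  ≡⟨ +%-absorbʳ (N ∸ a) (a + z) N ⟩
      (N ∸ a + (a + z)) % N      ≡⟨ cong (_% N) (sym (+-assoc (N ∸ a) a z)) ⟩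
      (N ∸ a + a + z) % N        ≡⟨ cong (λ r → (r + z) % N) (m∸n+n≡m a≤N) ⟩
      (N + z) % N                ≡⟨ cong (_% N) (+-comm N z) ⟩
      (z + N) % N                ≡⟨ [m+n]%n≡m%n z N ⟩
      z % N                      ≡⟨ m<n⇒m%n≡m z<N ⟩
      z                          ∎)

  toℕ-⊕ : ∀ {m} (x : Fin (suc m)) o → toℕ (x ⊕ o) ≡ (toℕ x + o) % suc m
  toℕ-⊕ {m} x zero    = sym (trans (cong (_% suc m) (+-identityʳ (toℕ x))) (m<n⇒m%n≡m (toℕ<n x)))
  toℕ-⊕ {m} x (suc o) = begin
    toℕ (next (x ⊕ o))                 ≡⟨ toℕ-next-% (x ⊕ o) ⟩
    suc (toℕ (x ⊕ o)) % suc m          ≡⟨ cong (λ r → suc r % suc m) (toℕ-⊕ x o) ⟩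
    (1 + (toℕ x + o) % suc m) % suc m  ≡⟨ +%-absorbʳ 1 (toℕ x + o) (suc m) ⟩
    suc (toℕ x + o) % suc m            ≡⟨ cong (_% suc m) (sym (+-suc (toℕ x) o)) ⟩
    (toℕ x + suc o) % suc m            ∎
    where open ≡-Reasoning

  ⊕-injective : ∀ {m} (x : Fin (suc m)) {o o′} → o < suc m → o′ < suc m → x ⊕ o ≡ x ⊕ o′ → o ≡ o′
  ⊕-injective x o<n o′<n eq = +%-cancelˡ (toℕ x) (<⇒≤ (toℕ<n x)) o<n o′<n
    (trans (sym (toℕ-⊕ x _)) (trans (cong toℕ eq) (toℕ-⊕ x _)))

  ⊕-+ : ∀ {m} (x : Fin (suc m)) o o′ → x ⊕ (o + o′) ≡ x ⊕ o ⊕ o′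
  ⊕-+ x o zero     = cong (x ⊕_) (+-identityʳ o)
  ⊕-+ x o (suc o′) = trans (cong (x ⊕_) (+-suc o o′)) (cong next (⊕-+ x o o′))

  ⊕-period : ∀ {m} (x : Fin (suc m)) → x ⊕ suc m ≡ x
  ⊕-period {m} x = toℕ-injective (begin
    toℕ (x ⊕ suc m)          ≡⟨ toℕ-⊕ x (suc m) ⟩
    (toℕ x + suc m) % suc m  ≡⟨ [m+n]%n≡m%n (toℕ x) (suc m) ⟩
    toℕ x % suc m            ≡⟨ m<n⇒m%n≡m (toℕ<n x) ⟩
    toℕ x                    ∎)
    where open ≡-Reasoning

  ⊕-surjective : ∀ {m} (x y : Fin (suc m)) → ∃[ o ] o < suc m × x ⊕ o ≡ y
  ⊕-surjective {m} x y = o , m%n<n (toℕ y + (suc m ∸ toℕ x)) (suc m) , toℕ-injective (begin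
    toℕ (x ⊕ o)                                  ≡⟨ toℕ-⊕ x o ⟩
    (toℕ x + o) % suc m                          ≡⟨ +%-absorbʳ (toℕ x) (toℕ y + (suc m ∸ toℕ x)) (suc m) ⟩
    (toℕ x + (toℕ y + (suc m ∸ toℕ x))) % suc m  ≡⟨ cong (_% suc m) x+[y+[n∸x]]≡y+n ⟩
    (toℕ y + suc m) % suc m                      ≡⟨ [m+n]%n≡m%n (toℕ y) (suc m) ⟩
    toℕ y % suc m                                ≡⟨ m<n⇒m%n≡m (toℕ<n y) ⟩
    toℕ y                                        ∎)
    where
    open ≡-Reasoning
    o : ℕ
    o = (toℕ y + (suc m ∸ toℕ x)) % suc m
    x+[y+[n∸x]]≡y+n : toℕ x + (toℕ y + (suc m ∸ toℕ x)) ≡ toℕ y + suc m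
    x+[y+[n∸x]]≡y+n = begin
      toℕ x + (toℕ y + (suc m ∸ toℕ x))  ≡⟨ sym (+-assoc (toℕ x) (toℕ y) _) ⟩
      toℕ x + toℕ y + (suc m ∸ toℕ x)    ≡⟨ cong (_+ (suc m ∸ toℕ x)) (+-comm (toℕ x) (toℕ y)) ⟩
      toℕ y + toℕ x + (suc m ∸ toℕ x)    ≡⟨ +-assoc (toℕ y) (toℕ x) _ ⟩
      toℕ y + (toℕ x + (suc m ∸ toℕ x))  ≡⟨ cong (toℕ y +_) (m+[n∸m]≡n (<⇒≤ (toℕ<n x))) ⟩
      toℕ y + suc m                      ∎

  next-injective : ∀ {m} {x y : Fin (suc m)} → next x ≡ next y → x ≡ y
  next-injective {x = x} {y} eq = toℕ-injective (+%-cancelˡ 1 (s≤s z≤n) (toℕ<n x) (toℕ<n y)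
    (trans (sym (toℕ-next-% x)) (trans (cong toℕ eq) (toℕ-next-% y))))

  next-prev : ∀ {m} (x : Fin (suc m)) → next (prev x) ≡ x
  next-prev = ⊕-period

  toℕ-prev-suc : ∀ {m} (x : Fin (suc m)) {j} → toℕ x ≡ suc j → toℕ (prev x) ≡ j
  toℕ-prev-suc {m} x {j} x≡j+1 = begin
    toℕ (x ⊕ m)          ≡⟨ toℕ-⊕ x m ⟩
    (toℕ x + m) % suc m  ≡⟨ cong (λ r → (r + m) % suc m) x≡j+1 ⟩
    (suc j + m) % suc m  ≡⟨ cong (_% suc m) (sym (+-suc j m)) ⟩
    (j + suc m) % suc m  ≡⟨ [m+n]%n≡m%n j (suc m) ⟩
    j % suc m            ≡⟨ m<n⇒m%n≡m (<-trans (n<1+n j) (subst (_< suc m) x≡j+1 (toℕ<n x))) ⟩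
    j                    ∎
    where open ≡-Reasoning

  toℕ-prev-zero : ∀ {m} (x : Fin (suc m)) → toℕ x ≡ 0 → toℕ (prev x) ≡ m
  toℕ-prev-zero {m} x x≡0 =
    trans (toℕ-⊕ x m) (trans (cong (λ r → (r + m) % suc m) x≡0) (m<n⇒m%n≡m (n<1+n m)))

module Counting where

  open import Data.Bool using (true; false; if_then_else_)
  open import Data.Nat.Properties using (+-suc)
  import Data.Fin as Fin
  import Data.Fin.Properties as Finₚ
  open import Data.List using (length; filter; tabulate)
  open import Data.Sum using (inj₁; inj₂; [_,_]′)
  open import Data.Empty using (⊥-elim)
  open import Function using (_∘_)
  open import Relation.Nullary using (¬_; yes; no; does)
  open import Relation.Unary using (Pred; Decidable)
  open import Relation.Binary.PropositionalEquality
  open import Level using (0ℓ)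

  count : ∀ {n} {P : Pred (Fin n) 0ℓ} → Decidable P → ℕ
  count {zero}  P? = 0
  count {suc n} P? = (if does (P? Fin.zero) then 1 else 0) + count (P? ∘ Fin.suc)

  count-cong : ∀ {n} {P Q : Pred (Fin n) 0ℓ} (P? : Decidable P) (Q? : Decidable Q) →
               (∀ k → P k → Q k) → (∀ k → Q k → P k) → count P? ≡ count Q?
  count-cong {zero}  P? Q? P⇒Q Q⇒P = refl
  count-cong {suc n} P? Q? P⇒Q Q⇒P with P? Fin.zero | Q? Fin.zero
  ... | yes p | no ¬q = ⊥-elim (¬q (P⇒Q Fin.zero p))
  ... | no ¬p | yes q = ⊥-elim (¬p (Q⇒P Fin.zero q))
  ... | yes _ | yes _ = cong suc (count-cong (P? ∘ Fin.suc) (Q? ∘ Fin.suc) (P⇒Q ∘ Fin.suc) (Q⇒P ∘ Fin.suc))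
  ... | no _  | no _  = count-cong (P? ∘ Fin.suc) (Q? ∘ Fin.suc) (P⇒Q ∘ Fin.suc) (Q⇒P ∘ Fin.suc)

  count-split : ∀ {n} {P Q R : Pred (Fin n) 0ℓ} (P? : Decidable P) (Q? : Decidable Q) (R? : Decidable R) →
                (∀ k → P k → Q k ⊎ R k) → (∀ k → Q k → P k) → (∀ k → R k → P k) →
                (∀ k → Q k → R k → ⊥) → count P? ≡ count Q? + count R?
  count-split {zero}  P? Q? R? P⇒Q⊎R Q⇒P R⇒P Q∩R=∅ = refl
  count-split {suc n} P? Q? R? P⇒Q⊎R Q⇒P R⇒P Q∩R=∅
    with P? Fin.zero | Q? Fin.zero | R? Fin.zero
       | count-split (P? ∘ Fin.suc) (Q? ∘ Fin.suc) (R? ∘ Fin.suc)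
                     (P⇒Q⊎R ∘ Fin.suc) (Q⇒P ∘ Fin.suc) (R⇒P ∘ Fin.suc) (Q∩R=∅ ∘ Fin.suc)
  ... | _     | yes q | yes r | _  = ⊥-elim (Q∩R=∅ Fin.zero q r)
  ... | no ¬p | yes q | no _  | _  = ⊥-elim (¬p (Q⇒P Fin.zero q))
  ... | no ¬p | no _  | yes r | _  = ⊥-elim (¬p (R⇒P Fin.zero r))
  ... | yes p | no ¬q | no ¬r | _  = ⊥-elim ([ ¬q , ¬r ]′ (P⇒Q⊎R Fin.zero p))
  ... | yes _ | yes _ | no _  | ih = cong suc ih
  ... | yes _ | no _  | yes _ | ih = trans (cong suc ih) (sym (+-suc _ _))
  ... | no _  | no _  | no _  | ih = ih

  count-none : ∀ {n} {P : Pred (Fin n) 0ℓ} (P? : Decidable P) → (∀ k → ¬ P k) → count P? ≡ 0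
  count-none {zero}  P? ¬P = refl
  count-none {suc n} P? ¬P with P? Fin.zero
  ... | yes p = ⊥-elim (¬P Fin.zero p)
  ... | no _  = count-none (P? ∘ Fin.suc) (¬P ∘ Fin.suc)

  count-single : ∀ {n} {P : Pred (Fin n) 0ℓ} (P? : Decidable P) x → P x → (∀ k → P k → k ≡ x) →
                 count P? ≡ 1
  count-single {suc n} P? Fin.zero P0 P⇒≡0 with P? Fin.zero
  ... | yes _  = cong suc (count-none (P? ∘ Fin.suc) (λ k Pk → Finₚ.0≢1+n (sym (P⇒≡0 (Fin.suc k) Pk))))
  ... | no ¬P0 = ⊥-elim (¬P0 P0)
  count-single {suc n} P? (Fin.suc x) Px P⇒≡x with P? Fin.zero
  ... | yes P0 = ⊥-elim (Finₚ.0≢1+n (P⇒≡x Fin.zero P0))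
  ... | no _   = count-single (P? ∘ Fin.suc) x Px (λ k Pk → Finₚ.suc-injective (P⇒≡x (Fin.suc k) Pk))

  length-filter-tabulate : ∀ {A : Set} {P : Pred A 0ℓ} (P? : Decidable P) {n} (f : Fin n → A) →
                           length (filter P? (tabulate f)) ≡ count (P? ∘ f)
  length-filter-tabulate P? {zero}  f = refl
  length-filter-tabulate P? {suc n} f with does (P? (f Fin.zero))
  ... | true  = cong suc (length-filter-tabulate P? (f ∘ Fin.suc))
  ... | false = length-filter-tabulate P? (f ∘ Fin.suc)

module SubsetCardinality where

  open import Data.Nat as ℕ using (_<_)
  open import Data.Nat.Properties using (<⇒≱; 1+n≢0)
  import Data.Fin as Fin
  open import Data.Fin.Properties using (any?)
  open import Data.Fin.Subset using (_∈_; _∉_; _⊆_; _∪_; _∩_; ∣_∣; Empty; Nonempty; inside; outside)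
  open import Data.Fin.Subset.Properties
    using (_∈?_; x∈p∪q⁻; x∈p∪q⁺; x∈p∩q⁺; drop-there; p⊆q⇒∣p∣≤∣q∣; p⊂q⇒∣p∣<∣q∣; ⊆-antisym;
           nonempty?; Empty-unique; ∣⊥∣≡0)
  open import Data.Vec using (_∷_; []; there)
  open import Data.Sum using (inj₁; inj₂)
  open import Data.Product using (_×_; _,_; ∃-syntax)
  open import Data.Empty using (⊥-elim)
  open import Function using (_∘_)
  open import Relation.Nullary using (¬?; yes; no)
  open import Relation.Nullary.Decidable using (_×-dec_; decidable-stable)
  open import Relation.Binary.PropositionalEquality
  open Counting

  ∣p∣≡count : ∀ {n} (p : Subset n) → ∣ p ∣ ≡ count (_∈? p)
  ∣p∣≡count []            = refl
  ∣p∣≡count (inside ∷ p)  = cong suc (trans (∣p∣≡count p)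
    (count-cong (_∈? p) (λ k → Fin.suc k ∈? (inside ∷ p)) (λ _ → there) (λ _ → drop-there)))
  ∣p∣≡count (outside ∷ p) = trans (∣p∣≡count p)
    (count-cong (_∈? p) (λ k → Fin.suc k ∈? (outside ∷ p)) (λ _ → there) (λ _ → drop-there))

  module _ {n : ℕ} where

    ∣p∪q∣≡∣p∣+∣q∣ : ∀ (p q : Subset n) → Empty (p ∩ q) → ∣ p ∪ q ∣ ≡ ∣ p ∣ + ∣ q ∣
    ∣p∪q∣≡∣p∣+∣q∣ p q p∩q=∅ = begin
      ∣ p ∪ q ∣                      ≡⟨ ∣p∣≡count (p ∪ q) ⟩
      count (_∈? (p ∪ q))            ≡⟨ count-split (_∈? (p ∪ q)) (_∈? p) (_∈? q)
                                          (λ _ → x∈p∪q⁻ p q) (λ _ → x∈p∪q⁺ ∘ inj₁) (λ _ → x∈p∪q⁺ ∘ inj₂)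
                                          (λ k x∈p x∈q → p∩q=∅ (k , x∈p∩q⁺ (x∈p , x∈q))) ⟩
      count (_∈? p) + count (_∈? q)  ≡⟨ sym (cong₂ _+_ (∣p∣≡count p) (∣p∣≡count q)) ⟩
      ∣ p ∣ + ∣ q ∣                  ∎
      where open ≡-Reasoning

    ⊆-or-∃∉ : ∀ (p q : Subset n) → p ⊆ q ⊎ ∃[ x ] x ∈ p × x ∉ q
    ⊆-or-∃∉ p q with any? (λ x → (x ∈? p) ×-dec ¬? (x ∈? q))
    ... | yes witness = inj₂ witness
    ... | no ∄        = inj₁ λ {x} x∈p → decidable-stable (x ∈? q) (λ x∉q → ∄ (x , x∈p , x∉q))

    ∣p∣<∣q∣⇒∃∈q∉p : ∀ (p q : Subset n) → ∣ p ∣ < ∣ q ∣ → ∃[ x ] x ∈ q × x ∉ p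
    ∣p∣<∣q∣⇒∃∈q∉p p q ∣p∣<∣q∣ with ⊆-or-∃∉ q p
    ... | inj₁ q⊆p     = ⊥-elim (<⇒≱ ∣p∣<∣q∣ (p⊆q⇒∣p∣≤∣q∣ q⊆p))
    ... | inj₂ witness = witness

    ⊆∧∣≥∣⇒≡ : ∀ {p q : Subset n} → p ⊆ q → ∣ q ∣ ≤ ∣ p ∣ → p ≡ q
    ⊆∧∣≥∣⇒≡ {p} {q} p⊆q ∣q∣≤∣p∣ with ⊆-or-∃∉ q p
    ... | inj₁ q⊆p     = ⊆-antisym p⊆q q⊆p
    ... | inj₂ witness = ⊥-elim (<⇒≱ (p⊂q⇒∣p∣<∣q∣ (p⊆q , witness)) ∣q∣≤∣p∣)

    ∣p∣≡1⇒Nonempty : ∀ {p : Subset n} → ∣ p ∣ ≡ 1 → Nonempty p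
    ∣p∣≡1⇒Nonempty {p} ∣p∣≡1 with nonempty? p
    ... | yes ne = ne
    ... | no ¬ne = ⊥-elim (1+n≢0 (trans (sym ∣p∣≡1) (trans (cong ∣_∣ (Empty-unique ¬ne)) (∣⊥∣≡0 n))))

module GaleEvenness where

  open import Data.Nat as ℕ using (_<_; z≤n; s≤s⁻¹)
  open import Data.Nat.Properties
    using (≤-antisym; n≢0⇒n>0; n≤1+n; <⇒≱; n≮0; +-comm; +-identityʳ; *-comm; ≤∧≢⇒<; <-trans; n<1+n;
           suc-injective)
  open import Data.Nat.Divisibility using (_∣_; divides; ∣m∣n⇒∣m+n)
  import Data.Fin as Fin
  open import Data.Fin using (toℕ)
  open import Data.Fin.Properties using (_<?_; toℕ-injective; toℕ<n; _≟_)
  open import Data.Fin.Subset using (_∈_; _∉_; _∪_; _∩_; ⁅_⁆; ∣_∣; Empty)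
  open import Data.Fin.Subset.Properties using (_∈?_; x∈p∪q⁻; x∈p∪q⁺; x∈p∩q⁺; x∈p∩q⁻; x∈⁅x⁆; x∈⁅y⁆⇒x≡y; ∣⁅x⁆∣≡1)
  open import Data.Sum using (inj₁; inj₂)
  open import Data.Product using (_×_; _,_; ∃-syntax)
  open import Data.Empty using (⊥-elim)
  open import Function using (_∘_; id)
  open import Relation.Nullary using (¬_; ¬?; yes; no)
  open import Relation.Nullary.Decidable using (_×-dec_; decidable-stable)
  open import Relation.Unary using (Decidable)
  open import Relation.Binary.PropositionalEquality
  open Cyclic
  open Counting
  open SubsetCardinality

  module _ {n : ℕ} where

    ∈-between? : ∀ (S : Subset n) (a b : Fin n) → Decidable (λ (k : Fin n) → a Fin.< k × k Fin.< b × k ∈ S)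
    ∈-between? S a b k = (a <? k) ×-dec ((k <? b) ×-dec (k ∈? S))

    between≡count : ∀ (S : Subset n) (a b : Fin n) → between S a b ≡ count (∈-between? S a b)
    between≡count S a b = length-filter-tabulate (∈-between? S a b) id

    between-∪ : ∀ (p q : Subset n) (a b : Fin n) → Empty (p ∩ q) →
                between (p ∪ q) a b ≡ between p a b + between q a b
    between-∪ p q a b p∩q=∅ = begin
      between (p ∪ q) a b                                  ≡⟨ between≡count (p ∪ q) a b ⟩
      count (∈-between? (p ∪ q) a b)                       ≡⟨ count-split (∈-between? (p ∪ q) a b)
                                                                (∈-between? p a b) (∈-between? q a b)
                                                                split (λ _ → ∈-∪ inj₁) (λ _ → ∈-∪ inj₂) disjoint ⟩
      count (∈-between? p a b) + count (∈-between? q a b)  ≡⟨ sym (cong₂ _+_ (between≡count p a b)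
                                                                                (between≡count q a b)) ⟩
      between p a b + between q a b                        ∎
      where
      open ≡-Reasoning
      split : ∀ k → a Fin.< k × k Fin.< b × k ∈ p ∪ q →
              (a Fin.< k × k Fin.< b × k ∈ p) ⊎ (a Fin.< k × k Fin.< b × k ∈ q)
      split k (a<k , k<b , k∈p∪q) with x∈p∪q⁻ p q k∈p∪q
      ... | inj₁ k∈p = inj₁ (a<k , k<b , k∈p)
      ... | inj₂ k∈q = inj₂ (a<k , k<b , k∈q)
      ∈-∪ : ∀ {k S} → (k ∈ S → k ∈ p ⊎ k ∈ q) → a Fin.< k × k Fin.< b × k ∈ S → a Fin.< k × k Fin.< b × k ∈ p ∪ q
      ∈-∪ inj (a<k , k<b , k∈S) = a<k , k<b , x∈p∪q⁺ (inj k∈S)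
      disjoint : ∀ k → a Fin.< k × k Fin.< b × k ∈ p → a Fin.< k × k Fin.< b × k ∈ q → ⊥
      disjoint k (_ , _ , k∈p) (_ , _ , k∈q) = p∩q=∅ (k , x∈p∩q⁺ (k∈p , k∈q))

    between≡1 : ∀ (u : Subset n) {a b : Fin n} x → x ∈ u → a Fin.< x → x Fin.< b →
                (∀ y → y ∈ u → a Fin.< y → y Fin.< b → y ≡ x) → between u a b ≡ 1
    between≡1 u {a} {b} x x∈u a<x x<b unique = trans (between≡count u a b)
      (count-single _ x (a<x , x<b , x∈u) (λ y (a<y , y<b , y∈u) → unique y y∈u a<y y<b))

    between≡3 : ∀ (u : Subset n) {a b : Fin n} x → ∣ u ∣ ≡ 4 → x ∈ u → ¬ (a Fin.< x × x Fin.< b) →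
                (∀ y → y ∈ u → y ≢ x → a Fin.< y × y Fin.< b) → between u a b ≡ 3
    between≡3 u {a} {b} x ∣u∣≡4 x∈u x∉ab others = suc-injective (begin
      suc (between u a b)                       ≡⟨ +-comm 1 _ ⟩
      between u a b + 1                         ≡⟨ cong₂ _+_ (between≡count u a b) (sym outside≡1) ⟩
      count (∈-between? u a b) + count outside  ≡⟨ sym (count-split (_∈? u) (∈-between? u a b) outside split
                                                     (λ _ (_ , _ , k∈u) → k∈u) (λ _ (_ , k∈u) → k∈u)
                                                     (λ _ (a<k , k<b , _) (k∉ab , _) → k∉ab (a<k , k<b))) ⟩
      count (_∈? u)                             ≡⟨ sym (∣p∣≡count u) ⟩
      ∣ u ∣                                     ≡⟨ ∣u∣≡4 ⟩
      4                                         ∎)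
      where
      open ≡-Reasoning
      outside : Decidable (λ (k : Fin n) → ¬ (a Fin.< k × k Fin.< b) × k ∈ u)
      outside k = ¬? ((a <? k) ×-dec (k <? b)) ×-dec (k ∈? u)
      split : ∀ k → k ∈ u → (a Fin.< k × k Fin.< b × k ∈ u) ⊎ (¬ (a Fin.< k × k Fin.< b) × k ∈ u)
      split k k∈u with (a <? k) ×-dec (k <? b)
      ... | yes (a<k , k<b) = inj₁ (a<k , k<b , k∈u)
      ... | no k∉ab         = inj₂ (k∉ab , k∈u)
      outside≡1 : count outside ≡ 1
      outside≡1 = count-single outside x (x∉ab , x∈u) λ y (y∉ab , y∈u) →
        decidable-stable (y ≟ x) (λ y≢x → y∉ab (others y y∈u y≢x))

    between-⁅⁆-inside : ∀ {a b : Fin n} r → a Fin.< r → r Fin.< b → between ⁅ r ⁆ a b ≡ 1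
    between-⁅⁆-inside r a<r r<b = between≡1 ⁅ r ⁆ r (x∈⁅x⁆ r) a<r r<b (λ y y∈⁅r⁆ _ _ → x∈⁅y⁆⇒x≡y r y∈⁅r⁆)

    between-⁅⁆-outside : ∀ {a b : Fin n} r → ¬ (a Fin.< r × r Fin.< b) → between ⁅ r ⁆ a b ≡ 0
    between-⁅⁆-outside {a} {b} r r∉ab = trans (between≡count ⁅ r ⁆ a b)
      (count-none (∈-between? ⁅ r ⁆ a b) λ k (a<k , k<b , k∈⁅r⁆) →
        r∉ab (subst (λ x → a Fin.< x × x Fin.< b) (x∈⁅y⁆⇒x≡y r k∈⁅r⁆) (a<k , k<b)))

  2∣n+n : ∀ n → 2 ∣ n + n
  2∣n+n n = divides n (trans (cong (n +_) (sym (+-identityʳ n))) (*-comm 2 n))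

  2∤1 : ¬ 2 ∣ 1
  2∤1 (divides zero ())
  2∤1 (divides (suc q) ())

  2∤3 : ¬ 2 ∣ 3
  2∤3 (divides zero ())
  2∤3 (divides (suc zero) ())
  2∤3 (divides (suc (suc q)) ())

  pair : ∀ {m} → Fin (suc m) → Subset (suc m)
  pair r = ⁅ r ⁆ ∪ ⁅ next r ⁆

  F≡pair : ∀ {m} (r : Fin (suc m)) → F r ≡ pair r
  F≡pair r = cong (λ x → ⁅ r ⁆ ∪ ⁅ x ⁆) (sym (next≡sucMod r))

  module _ {m : ℕ} where

    pair-cases : ∀ (r : Fin (suc m)) {x} → x ∈ pair r → x ≡ r ⊎ x ≡ next r
    pair-cases r x∈pair = Data.Sum.map (x∈⁅y⁆⇒x≡y r) (x∈⁅y⁆⇒x≡y (next r)) (x∈p∪q⁻ ⁅ r ⁆ ⁅ next r ⁆ x∈pair)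

    r∈pair : ∀ (r : Fin (suc m)) → r ∈ pair r
    r∈pair r = x∈p∪q⁺ (inj₁ (x∈⁅x⁆ r))

    next∈pair : ∀ (r : Fin (suc m)) → next r ∈ pair r
    next∈pair r = x∈p∪q⁺ (inj₂ (x∈⁅x⁆ (next r)))

  module _ {m : ℕ} where

    ≢next : ∀ (r : Fin (suc (suc m))) → r ≢ next r
    ≢next r r≡r⁺ with ⊕-injective r {0} {1} (s≤s z≤n) (s≤s (s≤s z≤n)) r≡r⁺
    ... | ()

    ⁅r⁆∩⁅next⁆=∅ : ∀ (r : Fin (suc (suc m))) → Empty (⁅ r ⁆ ∩ ⁅ next r ⁆)
    ⁅r⁆∩⁅next⁆=∅ r (x , x∈∩) with x∈p∩q⁻ ⁅ r ⁆ ⁅ next r ⁆ x∈∩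
    ... | x∈⁅r⁆ , x∈⁅r⁺⁆ = ≢next r (trans (sym (x∈⁅y⁆⇒x≡y r x∈⁅r⁆)) (x∈⁅y⁆⇒x≡y (next r) x∈⁅r⁺⁆))

    ∣pair∣≡2 : ∀ (r : Fin (suc (suc m))) → ∣ pair r ∣ ≡ 2
    ∣pair∣≡2 r = trans (∣p∪q∣≡∣p∣+∣q∣ ⁅ r ⁆ ⁅ next r ⁆ (⁅r⁆∩⁅next⁆=∅ r))
                       (cong₂ _+_ (∣⁅x⁆∣≡1 r) (∣⁅x⁆∣≡1 (next r)))

    -- Since a and b avoid r and next r, either both or none of them lie strictly between a and b.
    between-⁅r⁆≡between-⁅next⁆ : ∀ {a b} (r : Fin (suc (suc m))) → a ∉ pair r → b ∉ pair r →
                                  between ⁅ r ⁆ a b ≡ between ⁅ next r ⁆ a b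
    between-⁅r⁆≡between-⁅next⁆ {a} {b} r a∉pair b∉pair with toℕ-next r
    ... | inj₂ (r≡last , r⁺≡0) =
      trans (between-⁅⁆-outside {a = a} {b} r λ (_ , r<b) → r≮b r<b) (sym (between-⁅⁆-outside {a = a} {b} (next r) λ (a<r⁺ , _) → a≮r⁺ a<r⁺))
      where
      r≮b : ¬ r Fin.< b
      r≮b r<b = <⇒≱ r<b (subst (toℕ b ℕ.≤_) (sym r≡last) (s≤s⁻¹ (toℕ<n b)))
      a≮r⁺ : ¬ a Fin.< next r
      a≮r⁺ a<r⁺ = n≮0 (subst (toℕ a <_) (cong toℕ r⁺≡0) a<r⁺)
    ... | inj₁ (_ , r⁺≡r+1) with (a <? r) ×-dec (r <? b)
    ...   | yes (a<r , r<b) =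
      trans (between-⁅⁆-inside {a = a} {b} r a<r r<b) (sym (between-⁅⁆-inside {a = a} {b} (next r) a<r⁺ r⁺<b))
      where
      a<r⁺ : a Fin.< next r
      a<r⁺ = subst (toℕ a <_) (sym r⁺≡r+1) (<-trans a<r (n<1+n _))
      r⁺<b : next r Fin.< b
      r⁺<b = ≤∧≢⇒< (subst (ℕ._≤ toℕ b) (sym r⁺≡r+1) r<b)
                   (λ r⁺≡b → b∉pair (subst (_∈ pair r) (toℕ-injective r⁺≡b) (next∈pair r)))
    ...   | no r∉ab =
      trans (between-⁅⁆-outside {a = a} {b} r r∉ab) (sym (between-⁅⁆-outside {a = a} {b} (next r) λ (a<r⁺ , r⁺<b) → r∉ab (a<r a<r⁺ , r<b r⁺<b)))
      where
      a<r : a Fin.< next r → a Fin.< r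
      a<r a<r⁺ = ≤∧≢⇒< (s≤s⁻¹ (subst (toℕ a <_) r⁺≡r+1 a<r⁺))
                       (λ a≡r → a∉pair (subst (_∈ pair r) (sym (toℕ-injective a≡r)) (r∈pair r)))
      r<b : next r Fin.< b → r Fin.< b
      r<b r⁺<b = <-trans (n<1+n _) (subst (_< toℕ b) r⁺≡r+1 r⁺<b)

    between-pair-even : ∀ {a b} (r : Fin (suc (suc m))) → a ∉ pair r → b ∉ pair r → 2 ∣ between (pair r) a b
    between-pair-even {a} {b} r a∉pair b∉pair =
      subst (2 ∣_) (sym (trans (between-∪ ⁅ r ⁆ ⁅ next r ⁆ a b (⁅r⁆∩⁅next⁆=∅ r))
                               (cong (between ⁅ r ⁆ a b +_) (sym (between-⁅r⁆≡between-⁅next⁆ r a∉pair b∉pair)))))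
            (2∣n+n (between ⁅ r ⁆ a b))

    pair∪pair-isVertex : ∀ (r r′ : Fin (suc (suc m))) → Empty (pair r ∩ pair r′) → IsVertex (pair r ∪ pair r′)
    pair∪pair-isVertex r r′ disjoint = card , gale
      where
      card : ∣ pair r ∪ pair r′ ∣ ≡ 4
      card = trans (∣p∪q∣≡∣p∣+∣q∣ (pair r) (pair r′) disjoint) (cong₂ _+_ (∣pair∣≡2 r) (∣pair∣≡2 r′))
      gale : GaleEven (pair r ∪ pair r′)
      gale a b _ a∉ b∉ = subst (2 ∣_) (sym (between-∪ (pair r) (pair r′) a b disjoint))
        (∣m∣n⇒∣m+n (between-pair-even r (a∉ ∘ x∈p∪q⁺ ∘ inj₁) (b∉ ∘ x∈p∪q⁺ ∘ inj₁))
                   (between-pair-even r′ (a∉ ∘ x∈p∪q⁺ ∘ inj₂) (b∉ ∘ x∈p∪q⁺ ∘ inj₂)))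

  -- An element x of a vertex u has a cyclic neighbour in u: otherwise the non-elements prev x and
  -- next x violate Gale evenness, enclosing either x alone or the three other elements of u.
  module _ {k : ℕ} {u : Subset (3 + k)} where

    private
      toℕ-≢ : ∀ {y z} → y ∈ u → z ∉ u → toℕ y ≢ toℕ z
      toℕ-≢ y∈u z∉u y≡z = z∉u (subst (_∈ u) (toℕ-injective y≡z) y∈u)

    isolated-last : ∀ {x} → IsVertex u → x ∈ u → next x ∉ u → prev x ∉ u →
                    toℕ x ≡ 2 + k → next x ≡ Fin.zero → ⊥
    isolated-last {x} (∣u∣≡4 , gale) x∈u x⁺∉u x⁻∉u x≡last x⁺≡0 =
      2∤3 (subst (2 ∣_) (between≡3 u x ∣u∣≡4 x∈u x∉between others) (gale (next x) (prev x) x⁺<x⁻ x⁺∉u x⁻∉u))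
      where
      x⁺≡0′ : toℕ (next x) ≡ 0
      x⁺≡0′ = cong toℕ x⁺≡0
      x⁻≡k+1 : toℕ (prev x) ≡ suc k
      x⁻≡k+1 = toℕ-prev-suc x x≡last
      x⁺<x⁻ : next x Fin.< prev x
      x⁺<x⁻ = subst₂ _<_ (sym x⁺≡0′) (sym x⁻≡k+1) (s≤s z≤n)
      x∉between : ¬ (next x Fin.< x × x Fin.< prev x)
      x∉between (_ , x<x⁻) = <⇒≱ (subst₂ _<_ x≡last x⁻≡k+1 x<x⁻) (n≤1+n (suc k))
      others : ∀ y → y ∈ u → y ≢ x → next x Fin.< y × y Fin.< prev x
      others y y∈u y≢x =
        subst (_< toℕ y) (sym x⁺≡0′) (n≢0⇒n>0 (λ y≡0 → toℕ-≢ y∈u x⁺∉u (trans y≡0 (sym x⁺≡0′)))) ,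
        subst (toℕ y <_) (sym x⁻≡k+1)
          (≤∧≢⇒< (s≤s⁻¹ (≤∧≢⇒< (s≤s⁻¹ (toℕ<n y)) (λ y≡last → y≢x (toℕ-injective (trans y≡last (sym x≡last))))))
                 (λ y≡k+1 → toℕ-≢ y∈u x⁻∉u (trans y≡k+1 (sym x⁻≡k+1))))

    isolated-first : ∀ {x} → IsVertex u → x ∈ u → next x ∉ u → prev x ∉ u →
                     toℕ x ≡ 0 → toℕ (next x) ≡ 1 → ⊥
    isolated-first {x} (∣u∣≡4 , gale) x∈u x⁺∉u x⁻∉u x≡0 x⁺≡1 =
      2∤3 (subst (2 ∣_) (between≡3 u x ∣u∣≡4 x∈u x∉between others) (gale (next x) (prev x) x⁺<x⁻ x⁺∉u x⁻∉u))
      where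
      x⁻≡last : toℕ (prev x) ≡ 2 + k
      x⁻≡last = toℕ-prev-zero x x≡0
      x⁺<x⁻ : next x Fin.< prev x
      x⁺<x⁻ = subst₂ _<_ (sym x⁺≡1) (sym x⁻≡last) (s≤s (s≤s z≤n))
      x∉between : ¬ (next x Fin.< x × x Fin.< prev x)
      x∉between (x⁺<x , _) = n≮0 (subst₂ _<_ x⁺≡1 x≡0 x⁺<x)
      others : ∀ y → y ∈ u → y ≢ x → next x Fin.< y × y Fin.< prev x
      others y y∈u y≢x =
        subst (_< toℕ y) (sym x⁺≡1)
          (≤∧≢⇒< (n≢0⇒n>0 (λ y≡0 → y≢x (toℕ-injective (trans y≡0 (sym x≡0)))))
                 (λ 1≡y → toℕ-≢ y∈u x⁺∉u (trans (sym 1≡y) (sym x⁺≡1)))) ,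
        subst (toℕ y <_) (sym x⁻≡last)
          (≤∧≢⇒< (s≤s⁻¹ (toℕ<n y)) (λ y≡last → toℕ-≢ y∈u x⁻∉u (trans y≡last (sym x⁻≡last))))

    isolated-inner : ∀ {x j} → IsVertex u → x ∈ u → next x ∉ u → prev x ∉ u →
                     toℕ x ≡ suc j → toℕ (next x) ≡ suc (suc j) → ⊥
    isolated-inner {x} {j} (_ , gale) x∈u x⁺∉u x⁻∉u x≡j+1 x⁺≡j+2 =
      2∤1 (subst (2 ∣_) (between≡1 u x x∈u x⁻<x x<x⁺ unique) (gale (prev x) (next x) x⁻<x⁺ x⁻∉u x⁺∉u))
      where
      x⁻≡j : toℕ (prev x) ≡ j
      x⁻≡j = toℕ-prev-suc x x≡j+1
      x⁻<x : prev x Fin.< x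
      x⁻<x = subst₂ _<_ (sym x⁻≡j) (sym x≡j+1) (n<1+n j)
      x<x⁺ : x Fin.< next x
      x<x⁺ = subst₂ _<_ (sym x≡j+1) (sym x⁺≡j+2) (n<1+n (suc j))
      x⁻<x⁺ : prev x Fin.< next x
      x⁻<x⁺ = <-trans x⁻<x x<x⁺
      unique : ∀ y → y ∈ u → prev x Fin.< y → y Fin.< next x → y ≡ x
      unique y _ x⁻<y y<x⁺ = toℕ-injective (trans
        (≤-antisym (s≤s⁻¹ (subst (toℕ y <_) x⁺≡j+2 y<x⁺)) (subst (_< toℕ y) x⁻≡j x⁻<y))
        (sym x≡j+1))

    isolated⇒¬IsVertex : ∀ x → IsVertex u → x ∈ u → next x ∉ u → prev x ∉ u → ⊥
    isolated⇒¬IsVertex x isV x∈u x⁺∉u x⁻∉u with toℕ-next x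
    ... | inj₂ (x≡last , x⁺≡0) = isolated-last isV x∈u x⁺∉u x⁻∉u x≡last x⁺≡0
    isolated⇒¬IsVertex Fin.zero    isV x∈u x⁺∉u x⁻∉u | inj₁ (_ , x⁺≡1)   =
      isolated-first isV x∈u x⁺∉u x⁻∉u refl x⁺≡1
    isolated⇒¬IsVertex (Fin.suc y) isV x∈u x⁺∉u x⁻∉u | inj₁ (_ , x⁺≡y+2) =
      isolated-inner isV x∈u x⁺∉u x⁻∉u refl x⁺≡y+2

    IsVertex⇒no-isolated : ∀ {x} → IsVertex u → x ∈ u → next x ∈ u ⊎ prev x ∈ u
    IsVertex⇒no-isolated {x} isV x∈u with next x ∈? u | prev x ∈? u
    ... | yes x⁺∈u | _        = inj₁ x⁺∈u
    ... | no _     | yes x⁻∈u = inj₂ x⁻∈u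
    ... | no x⁺∉u  | no x⁻∉u  = ⊥-elim (isolated⇒¬IsVertex x isV x∈u x⁺∉u x⁻∉u)

module Face {k : ℕ} (b : Fin (5 + k)) where

  open import Data.Nat as ℕ using (_<_; z≤n; s≤s⁻¹)
  open import Data.Nat.Properties using (suc-injective; 1+n≢0; ≤-refl; ≤-reflexive)
  import Data.Fin as Fin
  open import Data.Fin using (toℕ; fromℕ<)
  open import Data.Fin.Properties using (toℕ-injective; toℕ<n; toℕ-fromℕ<; _≟_)
  open import Data.Fin.Subset using (_∈_; _∉_; _⊆_; _∪_; _∩_; ⁅_⁆; ∣_∣; Empty; Nonempty)
  open import Data.Fin.Subset.Properties
    using (x∈p∪q⁻; x∈p∪q⁺; x∈p∩q⁺; x∈p∩q⁻; x∈⁅x⁆; x∈⁅y⁆⇒x≡y; ∣⁅x⁆∣≡1; ⊆-antisym; p⊆p∪q;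
           ∪-distribˡ-∩; ∩-idem; ∪-comm; ∪-commutativeMonoid)
  open import Algebra.Bundles using (CommutativeMonoid)
  open import Data.Sum using (inj₁; inj₂; [_,_]′)
  open import Data.Product using (_×_; _,_; ∃-syntax; proj₁; proj₂)
  open import Data.Empty using (⊥-elim)
  open import Function using (_∘_)
  open import Relation.Nullary using (¬_; yes; no)
  open import Relation.Nullary.Decidable using (toSum)
  open import Relation.Binary.PropositionalEquality
  open Cyclic
  open SubsetCardinality
  open GaleEvenness

  m : ℕ
  m = 3 + k

  pos : Fin m → Fin (5 + k)
  pos t = b ⊕ (2 + toℕ t)

  extra : Fin m → Fin m → Subset (5 + k)
  extra t t′ = ⁅ pos t ⁆ ∪ ⁅ pos t′ ⁆

  -- corner t = {b, b+1, b+t+2, b+t+3}; the last corner wraps around to {b−1, b, b+1, b+2}.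
  corner : Fin m → Subset (5 + k)
  corner t = pair b ∪ extra t (next t)

  CyclicNeighbours : Fin m → Fin m → Set
  CyclicNeighbours t t′ = t′ ≡ next t ⊎ t ≡ next t′

  pos<n : ∀ t → 2 + toℕ t < 5 + k
  pos<n t = s≤s (s≤s (toℕ<n t))

  pos-injective : ∀ {t t′} → pos t ≡ pos t′ → t ≡ t′
  pos-injective {t} {t′} eq = toℕ-injective (suc-injective (suc-injective (⊕-injective b (pos<n t) (pos<n t′) eq)))

  pos∉pair : ∀ t → pos t ∉ pair b
  pos∉pair t pos∈pair with pair-cases b pos∈pair
  ... | inj₁ pos≡b with ⊕-injective b {o′ = 0} (pos<n t) (s≤s z≤n) pos≡b
  ...   | ()
  pos∉pair t pos∈pair | inj₂ pos≡b⁺ with ⊕-injective b {o′ = 1} (pos<n t) (s≤s (s≤s z≤n)) pos≡b⁺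
  ...   | ()

  ∉pair⇒pos : ∀ {x} → x ∉ pair b → ∃[ t ] x ≡ pos t
  ∉pair⇒pos {x} x∉pair with ⊕-surjective b x
  ... | zero , _ , b≡x           = ⊥-elim (x∉pair (subst (_∈ pair b) b≡x (r∈pair b)))
  ... | suc zero , _ , b⁺≡x      = ⊥-elim (x∉pair (subst (_∈ pair b) b⁺≡x (next∈pair b)))
  ... | suc (suc o) , o+2<n , b⊕o≡x =
    fromℕ< o<m , trans (sym b⊕o≡x) (cong (λ i → b ⊕ (2 + i)) (sym (toℕ-fromℕ< o<m)))
    where
    o<m : o < m
    o<m = s≤s⁻¹ (s≤s⁻¹ o+2<n)

  next-pos-cases : ∀ t → next (pos t) ≡ pos (next t) ⊎ (toℕ t ≡ 2 + k × next (pos t) ≡ b)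
  next-pos-cases t with toℕ-next t
  ... | inj₁ (_ , t⁺≡t+1) = inj₁ (cong (λ i → b ⊕ (2 + i)) (sym t⁺≡t+1))
  ... | inj₂ (t≡last , _) = inj₂ (t≡last , trans (cong (λ i → b ⊕ (3 + i)) t≡last) (⊕-period b))

  ≢next² : ∀ (t : Fin m) → t ≢ next (next t)
  ≢next² t t≡t⁺⁺ with ⊕-injective t {0} {2} (s≤s z≤n) (s≤s (s≤s (s≤s z≤n))) t≡t⁺⁺
  ... | ()

  ∈pair∪extra⁻ : ∀ {x t t′} → x ∈ pair b ∪ extra t t′ → x ∈ pair b ⊎ x ≡ pos t ⊎ x ≡ pos t′
  ∈pair∪extra⁻ {x} {t} {t′} x∈ with x∈p∪q⁻ (pair b) (extra t t′) x∈
  ... | inj₁ x∈pair  = inj₁ x∈pair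
  ... | inj₂ x∈extra = inj₂ (Data.Sum.map (x∈⁅y⁆⇒x≡y (pos t)) (x∈⁅y⁆⇒x≡y (pos t′)) (x∈p∪q⁻ _ _ x∈extra))

  pos∈pair∪extra : ∀ t t′ → pos t ∈ pair b ∪ extra t t′
  pos∈pair∪extra t t′ = x∈p∪q⁺ (inj₂ (x∈p∪q⁺ (inj₁ (x∈⁅x⁆ (pos t)))))

  extra∉pair : ∀ {x t t′} → x ∈ extra t t′ → x ∉ pair b
  extra∉pair {t = t} {t′} x∈extra with x∈p∪q⁻ ⁅ pos t ⁆ ⁅ pos t′ ⁆ x∈extra
  ... | inj₁ x∈⁅t⁆  = subst (_∉ pair b) (sym (x∈⁅y⁆⇒x≡y (pos t) x∈⁅t⁆)) (pos∉pair t)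
  ... | inj₂ x∈⁅t′⁆ = subst (_∉ pair b) (sym (x∈⁅y⁆⇒x≡y (pos t′) x∈⁅t′⁆)) (pos∉pair t′)

  ∣pair∪X∣≡2+∣X∣ : ∀ {X} → (∀ {x} → x ∈ X → x ∉ pair b) → ∣ pair b ∪ X ∣ ≡ 2 + ∣ X ∣
  ∣pair∪X∣≡2+∣X∣ {X} X∉pair = trans (∣p∪q∣≡∣p∣+∣q∣ (pair b) X pair∩X=∅) (cong (_+ ∣ X ∣) (∣pair∣≡2 b))
    where
    pair∩X=∅ : Empty (pair b ∩ X)
    pair∩X=∅ (x , x∈pair∩X) = let x∈pair , x∈X = x∈p∩q⁻ (pair b) X x∈pair∩X in X∉pair x∈X x∈pair

  ∣pair∪extra∣≡4 : ∀ {t t′} → t ≢ t′ → ∣ pair b ∪ extra t t′ ∣ ≡ 4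
  ∣pair∪extra∣≡4 {t} {t′} t≢t′ = trans (∣pair∪X∣≡2+∣X∣ (extra∉pair {t = t} {t′}))
    (cong (2 +_) (trans (∣p∪q∣≡∣p∣+∣q∣ ⁅ pos t ⁆ ⁅ pos t′ ⁆ disjoint) (cong₂ _+_ (∣⁅x⁆∣≡1 (pos t)) (∣⁅x⁆∣≡1 (pos t′)))))
    where
    disjoint : Empty (⁅ pos t ⁆ ∩ ⁅ pos t′ ⁆)
    disjoint (x , x∈∩) with x∈p∩q⁻ ⁅ pos t ⁆ ⁅ pos t′ ⁆ x∈∩
    ... | x∈⁅t⁆ , x∈⁅t′⁆ = t≢t′ (pos-injective (trans (sym (x∈⁅y⁆⇒x≡y (pos t) x∈⁅t⁆)) (x∈⁅y⁆⇒x≡y (pos t′) x∈⁅t′⁆)))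

  corner-isVertex : ∀ t → IsVertex (corner t)
  corner-isVertex t with next-pos-cases t
  ... | inj₁ pos⁺≡pos[t⁺] =
    subst IsVertex (cong (λ x → pair b ∪ (⁅ pos t ⁆ ∪ ⁅ x ⁆)) pos⁺≡pos[t⁺]) (pair∪pair-isVertex b (pos t) disjoint)
    where
    disjoint : Empty (pair b ∩ pair (pos t))
    disjoint (x , x∈∩) with x∈p∩q⁻ (pair b) (pair (pos t)) x∈∩
    ... | x∈pair , x∈pair[pos] with pair-cases (pos t) x∈pair[pos]
    ...   | inj₁ refl = pos∉pair t x∈pair
    ...   | inj₂ refl = pos∉pair (next t) (subst (_∈ pair b) pos⁺≡pos[t⁺] x∈pair)
  ... | inj₂ (t≡last , pos⁺≡b) =
    subst IsVertex (sym corner≡pair∪pair) (pair∪pair-isVertex (pos t) (next b) disjoint)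
    where
    open import Algebra.Properties.CommutativeSemigroup
      (CommutativeMonoid.commutativeSemigroup (∪-commutativeMonoid (5 + k))) using (interchange)
    t⁺≡0 : next t ≡ Fin.zero
    t⁺≡0 = next-last t t≡last
    corner≡pair∪pair : corner t ≡ pair (pos t) ∪ pair (next b)
    corner≡pair∪pair = begin
      (⁅ b ⁆ ∪ ⁅ next b ⁆) ∪ (⁅ pos t ⁆ ∪ ⁅ pos (next t) ⁆)  ≡⟨ cong (λ i → pair b ∪ (⁅ pos t ⁆ ∪ ⁅ pos i ⁆)) t⁺≡0 ⟩
      (⁅ b ⁆ ∪ ⁅ next b ⁆) ∪ (⁅ pos t ⁆ ∪ ⁅ next (next b) ⁆)  ≡⟨ interchange ⁅ b ⁆ ⁅ next b ⁆ ⁅ pos t ⁆ _ ⟩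
      (⁅ b ⁆ ∪ ⁅ pos t ⁆) ∪ pair (next b)                     ≡⟨ cong (_∪ pair (next b)) (∪-comm ⁅ b ⁆ ⁅ pos t ⁆) ⟩
      (⁅ pos t ⁆ ∪ ⁅ b ⁆) ∪ pair (next b)                     ≡⟨ cong (λ x → (⁅ pos t ⁆ ∪ ⁅ x ⁆) ∪ pair (next b)) (sym pos⁺≡b) ⟩
      pair (pos t) ∪ pair (next b)                            ∎
      where open ≡-Reasoning
    differ : ∀ {o o′} → o < 5 + k → o′ < 5 + k → o ≢ o′ → b ⊕ o ≢ b ⊕ o′
    differ o<n o′<n o≢o′ eq = o≢o′ (⊕-injective b o<n o′<n eq)
    disjoint : Empty (pair (pos t) ∩ pair (next b))
    disjoint (x , x∈∩) with x∈p∩q⁻ (pair (pos t)) (pair (next b)) x∈∩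
    ... | x∈pair[pos] , x∈pair[b⁺] with pair-cases (pos t) x∈pair[pos] | pair-cases (next b) x∈pair[b⁺]
    ...   | inj₁ x≡pos  | inj₁ x≡b⁺  = differ (pos<n t) (s≤s (s≤s z≤n)) (λ ()) (trans (sym x≡pos) x≡b⁺)
    ...   | inj₁ x≡pos  | inj₂ x≡b⁺⁺ = differ (pos<n t) (s≤s (s≤s (s≤s z≤n)))
                                        (λ eq → 1+n≢0 (trans (sym t≡last) (suc-injective (suc-injective eq))))
                                        (trans (sym x≡pos) x≡b⁺⁺)
    ...   | inj₂ x≡pos⁺ | inj₁ x≡b⁺  = differ {0} {1} (s≤s z≤n) (s≤s (s≤s z≤n)) (λ ())
                                        (trans (sym pos⁺≡b) (trans (sym x≡pos⁺) x≡b⁺))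
    ...   | inj₂ x≡pos⁺ | inj₂ x≡b⁺⁺ = differ {0} {2} (s≤s z≤n) (s≤s (s≤s (s≤s z≤n))) (λ ())
                                        (trans (sym pos⁺≡b) (trans (sym x≡pos⁺) x≡b⁺⁺))

  successor∈⇒neighbour-or-last : ∀ {t t′} → next (pos t) ∈ pair b ∪ extra t t′ → t′ ≡ next t ⊎ toℕ t ≡ 2 + k
  successor∈⇒neighbour-or-last {t} {t′} pos⁺∈ with next-pos-cases t
  ... | inj₂ (t≡last , _) = inj₂ t≡last
  ... | inj₁ pos⁺≡pos[t⁺] with ∈pair∪extra⁻ {t = t} {t′} pos⁺∈
  ...   | inj₁ pos⁺∈pair       = ⊥-elim (pos∉pair (next t) (subst (_∈ pair b) pos⁺≡pos[t⁺] pos⁺∈pair))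
  ...   | inj₂ (inj₁ pos⁺≡pos)  = ⊥-elim (≢next (pos t) (sym pos⁺≡pos))
  ...   | inj₂ (inj₂ pos⁺≡pos′) = inj₁ (sym (pos-injective (trans (sym pos⁺≡pos[t⁺]) pos⁺≡pos′)))

  predecessor∈⇒neighbour-or-first : ∀ {t t′} → prev (pos t) ∈ pair b ∪ extra t t′ → t ≡ next t′ ⊎ toℕ t ≡ 0
  predecessor∈⇒neighbour-or-first {t} {t′} pos⁻∈ with ∈pair∪extra⁻ {t = t} {t′} pos⁻∈
  ... | inj₂ (inj₁ pos⁻≡pos) = ⊥-elim (≢next (pos t) (trans (sym (next-prev (pos t))) (cong next pos⁻≡pos)))
  ... | inj₂ (inj₂ pos⁻≡pos′) with next-pos-cases t′
  ...   | inj₁ pos′⁺≡pos[t′⁺] =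
    inj₁ (pos-injective (trans (sym (next-prev (pos t))) (trans (cong next pos⁻≡pos′) pos′⁺≡pos[t′⁺])))
  ...   | inj₂ (_ , pos′⁺≡b) =
    ⊥-elim (pos∉pair t (subst (_∈ pair b) (trans (sym pos′⁺≡b) (trans (cong next (sym pos⁻≡pos′)) (next-prev (pos t))))
                                           (r∈pair b)))
  predecessor∈⇒neighbour-or-first {t} {t′} pos⁻∈ | inj₁ pos⁻∈pair with pair-cases b pos⁻∈pair
  ... | inj₁ pos⁻≡b =
    ⊥-elim (pos∉pair t (subst (_∈ pair b) (trans (cong next (sym pos⁻≡b)) (next-prev (pos t))) (next∈pair b)))
  ... | inj₂ pos⁻≡b⁺ = inj₂ (sym (suc-injective (suc-injective
    (⊕-injective b {2} (s≤s (s≤s (s≤s z≤n))) (pos<n t) (trans (cong next (sym pos⁻≡b⁺)) (next-prev (pos t)))))))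

  End : Fin m → Set
  End t = toℕ t ≡ 0 ⊎ toℕ t ≡ 2 + k

  extra-neighbours-or-end : ∀ {t t′} → IsVertex (pair b ∪ extra t t′) → CyclicNeighbours t t′ ⊎ End t
  extra-neighbours-or-end {t} {t′} isV with IsVertex⇒no-isolated isV (pos∈pair∪extra t t′)
  ... | inj₁ pos⁺∈ = Data.Sum.map inj₁ inj₂ (successor∈⇒neighbour-or-last pos⁺∈)
  ... | inj₂ pos⁻∈ = Data.Sum.map inj₂ inj₁ (predecessor∈⇒neighbour-or-first pos⁻∈)

  -- The two ends 0 and 2 + k of Fin m are themselves cyclic neighbours.
  neighbours-or-ends : ∀ {t t′} → t ≢ t′ → CyclicNeighbours t t′ ⊎ End t → CyclicNeighbours t′ t ⊎ End t′ →
                       CyclicNeighbours t t′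
  neighbours-or-ends _ (inj₁ t~t′) _ = t~t′
  neighbours-or-ends _ _ (inj₁ t′~t) = Data.Sum.swap t′~t
  neighbours-or-ends t≢t′ (inj₂ (inj₁ t≡0)) (inj₂ (inj₁ t′≡0)) = ⊥-elim (t≢t′ (toℕ-injective (trans t≡0 (sym t′≡0))))
  neighbours-or-ends t≢t′ (inj₂ (inj₂ t≡l)) (inj₂ (inj₂ t′≡l)) = ⊥-elim (t≢t′ (toℕ-injective (trans t≡l (sym t′≡l))))
  neighbours-or-ends {t′ = t′} _ (inj₂ (inj₁ t≡0)) (inj₂ (inj₂ t′≡l)) =
    inj₂ (trans (toℕ-injective t≡0) (sym (next-last t′ t′≡l)))
  neighbours-or-ends {t} _ (inj₂ (inj₂ t≡l)) (inj₂ (inj₁ t′≡0)) =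
    inj₁ (trans (toℕ-injective t′≡0) (sym (next-last t t≡l)))

  extra-neighbours : ∀ {t t′} → IsVertex (pair b ∪ extra t t′) → t ≢ t′ → CyclicNeighbours t t′
  extra-neighbours {t} {t′} isV t≢t′ = neighbours-or-ends t≢t′ (extra-neighbours-or-end isV)
    (extra-neighbours-or-end (subst IsVertex (cong (pair b ∪_) (∪-comm ⁅ pos t ⁆ ⁅ pos t′ ⁆)) isV))

  pair⊆corner : ∀ t → pair b ⊆ corner t
  pair⊆corner t = p⊆p∪q (extra t (next t))

  pos∈corner : ∀ t → pos t ∈ corner t
  pos∈corner t = pos∈pair∪extra t (next t)

  ∃pos∈ : ∀ {u} → ∣ u ∣ ≡ 4 → ∃[ t ] pos t ∈ u
  ∃pos∈ {u} ∣u∣≡4 =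
    let y , y∈u , y∉pair = ∣p∣<∣q∣⇒∃∈q∉p (pair b) u (subst₂ _<_ (sym (∣pair∣≡2 b)) (sym ∣u∣≡4) (s≤s (s≤s (s≤s z≤n))))
        t , y≡pos = ∉pair⇒pos y∉pair
    in t , subst (_∈ u) y≡pos y∈u

  ∣pair∪⁅pos⁆∣≡3 : ∀ t → ∣ pair b ∪ ⁅ pos t ⁆ ∣ ≡ 3
  ∣pair∪⁅pos⁆∣≡3 t = trans (∣pair∪X∣≡2+∣X∣ (λ x∈ → subst (_∉ pair b) (sym (x∈⁅y⁆⇒x≡y (pos t) x∈)) (pos∉pair t)))
                           (cong (2 +_) (∣⁅x⁆∣≡1 (pos t)))

  ∃pos∈-other : ∀ {u} t → ∣ u ∣ ≡ 4 → ∃[ t′ ] t ≢ t′ × pos t′ ∈ u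
  ∃pos∈-other {u} t ∣u∣≡4 =
    let y , y∈u , y∉ = ∣p∣<∣q∣⇒∃∈q∉p (pair b ∪ ⁅ pos t ⁆) u (subst₂ _<_ (sym (∣pair∪⁅pos⁆∣≡3 t)) (sym ∣u∣≡4) ≤-refl)
        t′ , y≡pos′ = ∉pair⇒pos (y∉ ∘ x∈p∪q⁺ ∘ inj₁)
        t≢t′ : t ≢ t′
        t≢t′ t≡t′ = y∉ (x∈p∪q⁺ (inj₂ (subst (_∈ ⁅ pos t ⁆) (trans (cong pos t≡t′) (sym y≡pos′)) (x∈⁅x⁆ (pos t)))))
    in t′ , t≢t′ , subst (_∈ u) y≡pos′ y∈u

  pair∪extra⊆ : ∀ {u t t′} → pair b ⊆ u → pos t ∈ u → pos t′ ∈ u → pair b ∪ extra t t′ ⊆ u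
  pair∪extra⊆ {u} {t} {t′} pair⊆u pos∈u pos′∈u x∈ with ∈pair∪extra⁻ {t = t} {t′} x∈
  ... | inj₁ x∈pair       = pair⊆u x∈pair
  ... | inj₂ (inj₁ x≡pos)  = subst (_∈ u) (sym x≡pos) pos∈u
  ... | inj₂ (inj₂ x≡pos′) = subst (_∈ u) (sym x≡pos′) pos′∈u

  IsVertex⊇pair⇒pair∪extra : ∀ {u} → IsVertex u → pair b ⊆ u → ∃[ t ] ∃[ t′ ] t ≢ t′ × pair b ∪ extra t t′ ≡ u
  IsVertex⊇pair⇒pair∪extra {u} (∣u∣≡4 , _) pair⊆u =
    let t , pos∈u = ∃pos∈ ∣u∣≡4
        t′ , t≢t′ , pos′∈u = ∃pos∈-other t ∣u∣≡4
    in t , t′ , t≢t′ , ⊆∧∣≥∣⇒≡ (pair∪extra⊆ {u} {t} {t′} pair⊆u pos∈u pos′∈u)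
                                (≤-reflexive (trans ∣u∣≡4 (sym (∣pair∪extra∣≡4 t≢t′))))

  corner-cover : ∀ {u} → IsVertex u → pair b ⊆ u → ∃[ t ] u ≡ corner t
  corner-cover {u} isV pair⊆u = [ via-t , via-t′ ]′ (extra-neighbours {t} {t′} (subst IsVertex (sym pair∪extra≡u) isV) t≢t′)
    where
    found = IsVertex⊇pair⇒pair∪extra {u} isV pair⊆u
    t  = proj₁ found
    t′ = proj₁ (proj₂ found)
    t≢t′ : t ≢ t′
    t≢t′ = proj₁ (proj₂ (proj₂ found))
    pair∪extra≡u : pair b ∪ extra t t′ ≡ u
    pair∪extra≡u = proj₂ (proj₂ (proj₂ found))
    via-t : t′ ≡ next t → ∃[ s ] u ≡ corner s
    via-t t′≡t⁺ = t , trans (sym pair∪extra≡u) (cong (λ x → pair b ∪ extra t x) t′≡t⁺)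
    via-t′ : t ≡ next t′ → ∃[ s ] u ≡ corner s
    via-t′ t≡t′⁺ = t′ , trans (sym pair∪extra≡u)
      (trans (cong (pair b ∪_) (∪-comm ⁅ pos t ⁆ ⁅ pos t′ ⁆)) (cong (λ x → pair b ∪ extra t′ x) t≡t′⁺))

  ⁅⁆-shared : ∀ {x p q : Fin (2 + m)} → x ∈ ⁅ p ⁆ → x ∈ ⁅ q ⁆ → p ≡ q
  ⁅⁆-shared {x} {p} {q} x∈⁅p⁆ x∈⁅q⁆ = trans (sym (x∈⁅y⁆⇒x≡y p x∈⁅p⁆)) (x∈⁅y⁆⇒x≡y q x∈⁅q⁆)

  ∣corner∩corner∣ : ∀ t t′ → ∣ corner t ∩ corner t′ ∣ ≡ 2 + ∣ extra t (next t) ∩ extra t′ (next t′) ∣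
  ∣corner∩corner∣ t t′ =
    trans (cong ∣_∣ (sym (∪-distribˡ-∩ (pair b) (extra t (next t)) (extra t′ (next t′)))))
          (∣pair∪X∣≡2+∣X∣ {extra t (next t) ∩ extra t′ (next t′)} X∉pair)
    where
    X∉pair : ∀ {x} → x ∈ extra t (next t) ∩ extra t′ (next t′) → x ∉ pair b
    X∉pair {x} x∈ = extra∉pair {x} {t} {next t} (proj₁ (x∈p∩q⁻ (extra t (next t)) (extra t′ (next t′)) x∈))

  extra∩extra⁺ : ∀ t → extra t (next t) ∩ extra (next t) (next (next t)) ≡ ⁅ pos (next t) ⁆
  extra∩extra⁺ t = ⊆-antisym ⊆⁅t⁺⁆ ⁅t⁺⁆⊆
    where
    t⁺ t⁺⁺ : Fin m
    t⁺  = next t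
    t⁺⁺ = next t⁺
    only-t⁺ : ∀ {x} → x ∈ ⁅ pos t ⁆ ⊎ x ∈ ⁅ pos t⁺ ⁆ → x ∈ ⁅ pos t⁺ ⁆ ⊎ x ∈ ⁅ pos t⁺⁺ ⁆ → x ∈ ⁅ pos t⁺ ⁆
    only-t⁺ (inj₂ x∈⁅t⁺⁆) _             = x∈⁅t⁺⁆
    only-t⁺ _             (inj₁ x∈⁅t⁺⁆) = x∈⁅t⁺⁆
    only-t⁺ (inj₁ x∈⁅t⁆)  (inj₂ x∈⁅t⁺⁺⁆) = ⊥-elim (≢next² t (pos-injective {t} {t⁺⁺} (⁅⁆-shared x∈⁅t⁆ x∈⁅t⁺⁺⁆)))
    ⊆⁅t⁺⁆ : extra t t⁺ ∩ extra t⁺ t⁺⁺ ⊆ ⁅ pos t⁺ ⁆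
    ⊆⁅t⁺⁆ {x} x∈ = let x∈₁ , x∈₂ = x∈p∩q⁻ (extra t t⁺) (extra t⁺ t⁺⁺) x∈ in
      only-t⁺ (x∈p∪q⁻ ⁅ pos t ⁆ ⁅ pos t⁺ ⁆ x∈₁) (x∈p∪q⁻ ⁅ pos t⁺ ⁆ ⁅ pos t⁺⁺ ⁆ x∈₂)
    ⁅t⁺⁆⊆ : ⁅ pos t⁺ ⁆ ⊆ extra t t⁺ ∩ extra t⁺ t⁺⁺
    ⁅t⁺⁆⊆ x∈ = x∈p∩q⁺ {p = extra t t⁺} {q = extra t⁺ t⁺⁺}
      (x∈p∪q⁺ {p = ⁅ pos t ⁆} {q = ⁅ pos t⁺ ⁆} (inj₂ x∈) , x∈p∪q⁺ {p = ⁅ pos t⁺ ⁆} {q = ⁅ pos t⁺⁺ ⁆} (inj₁ x∈))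

  corner-adjacent : ∀ t → Adj (corner t) (corner (next t))
  corner-adjacent t = corner-isVertex t , corner-isVertex (next t) ,
    trans (∣corner∩corner∣ t (next t)) (cong (2 +_) (trans (cong ∣_∣ (extra∩extra⁺ t)) (∣⁅x⁆∣≡1 (pos (next t)))))

  shared-extra⇒neighbours : ∀ {t t′ x} → t ≢ t′ →
                            x ∈ ⁅ pos t ⁆ ⊎ x ∈ ⁅ pos (next t) ⁆ → x ∈ ⁅ pos t′ ⁆ ⊎ x ∈ ⁅ pos (next t′) ⁆ →
                            CyclicNeighbours t t′
  shared-extra⇒neighbours {t} {t′} t≢t′ (inj₁ x∈⁅t⁆)  (inj₁ x∈⁅t′⁆) =
    ⊥-elim (t≢t′ (pos-injective {t} {t′} (⁅⁆-shared x∈⁅t⁆ x∈⁅t′⁆)))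
  shared-extra⇒neighbours {t} {t′} t≢t′ (inj₁ x∈⁅t⁆)  (inj₂ x∈⁅t′⁺⁆) =
    inj₂ (pos-injective {t} {next t′} (⁅⁆-shared x∈⁅t⁆ x∈⁅t′⁺⁆))
  shared-extra⇒neighbours {t} {t′} t≢t′ (inj₂ x∈⁅t⁺⁆) (inj₁ x∈⁅t′⁆) =
    inj₁ (sym (pos-injective {next t} {t′} (⁅⁆-shared x∈⁅t⁺⁆ x∈⁅t′⁆)))
  shared-extra⇒neighbours {t} {t′} t≢t′ (inj₂ x∈⁅t⁺⁆) (inj₂ x∈⁅t′⁺⁆) =
    ⊥-elim (t≢t′ (next-injective (pos-injective {next t} {next t′} (⁅⁆-shared x∈⁅t⁺⁆ x∈⁅t′⁺⁆))))

  ¬Adj-self : ∀ t → ¬ Adj (corner t) (corner t)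
  ¬Adj-self t (_ , _ , ∣∩∣≡3) =
    4≢3 (trans (sym (∣pair∪extra∣≡4 {t} {next t} (≢next t))) (trans (cong ∣_∣ (sym (∩-idem (corner t)))) ∣∩∣≡3))
    where
    4≢3 : 4 ≢ 3
    4≢3 ()

  Adj⇒extra∩extra≢∅ : ∀ {t t′} → Adj (corner t) (corner t′) → Nonempty (extra t (next t) ∩ extra t′ (next t′))
  Adj⇒extra∩extra≢∅ {t} {t′} (_ , _ , ∣∩∣≡3) =
    ∣p∣≡1⇒Nonempty {p = extra t (next t) ∩ extra t′ (next t′)}
      (suc-injective (suc-injective (trans (sym (∣corner∩corner∣ t t′)) ∣∩∣≡3)))

  corner-neighbours : ∀ {t t′} → Adj (corner t) (corner t′) → CyclicNeighbours t t′
  corner-neighbours {t} {t′} adj = [ same , different ]′ (toSum (t ≟ t′))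
    where
    same : t ≡ t′ → CyclicNeighbours t t′
    same t≡t′ = ⊥-elim (¬Adj-self t (subst (λ s → Adj (corner t) (corner s)) (sym t≡t′) adj))
    shared : Nonempty (extra t (next t) ∩ extra t′ (next t′))
    shared = Adj⇒extra∩extra≢∅ {t} {t′} adj
    x∈both : proj₁ shared ∈ extra t (next t) × proj₁ shared ∈ extra t′ (next t′)
    x∈both = x∈p∩q⁻ (extra t (next t)) (extra t′ (next t′)) (proj₂ shared)
    different : t ≢ t′ → CyclicNeighbours t t′
    different t≢t′ = shared-extra⇒neighbours {t} {t′} {proj₁ shared} t≢t′
      (x∈p∪q⁻ ⁅ pos t ⁆ ⁅ pos (next t) ⁆ (proj₁ x∈both)) (x∈p∪q⁻ ⁅ pos t′ ⁆ ⁅ pos (next t′) ⁆ (proj₂ x∈both))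

  corner-injective : ∀ {t t′} → corner t ≡ corner t′ → t ≡ t′
  corner-injective {t} {t′} eq = [ in-pair , [ pos-injective {t} {t′} , via-t′⁺ ]′ ]′
    (∈pair∪extra⁻ {t = t′} {next t′} (subst (pos t ∈_) eq (pos∈corner t)))
    where
    in-pair : pos t ∈ pair b → t ≡ t′
    in-pair pos∈pair = ⊥-elim (pos∉pair t pos∈pair)
    via-t′⁺ : pos t ≡ pos (next t′) → t ≡ t′
    via-t′⁺ pos≡pos′⁺ = [ in-pair′ , [ via-t , via-t⁺ ]′ ]′
      (∈pair∪extra⁻ {t = t} {next t} (subst (pos t′ ∈_) (sym eq) (pos∈corner t′)))
      where
      t≡t′⁺ : t ≡ next t′
      t≡t′⁺ = pos-injective {t} {next t′} pos≡pos′⁺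
      in-pair′ : pos t′ ∈ pair b → t ≡ t′
      in-pair′ pos′∈pair = ⊥-elim (pos∉pair t′ pos′∈pair)
      via-t : pos t′ ≡ pos t → t ≡ t′
      via-t pos′≡pos = sym (pos-injective {t′} {t} pos′≡pos)
      via-t⁺ : pos t′ ≡ pos (next t) → t ≡ t′
      via-t⁺ pos′≡pos⁺ = ⊥-elim (≢next² t′
        (subst (λ (s : Fin m) → t′ ≡ next s) t≡t′⁺ (pos-injective {t′} {next t} pos′≡pos⁺)))

  pair[b⁺]⊆corner : ∀ {t} → pos Fin.zero ∈ corner t → pair (next b) ⊆ corner t
  pair[b⁺]⊆corner {t} pos₀∈corner {x} x∈pair = [ via-b⁺ , via-b⁺⁺ ]′ (pair-cases (next b) x∈pair)
    where
    via-b⁺ : x ≡ next b → x ∈ corner t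
    via-b⁺ x≡b⁺ = pair⊆corner t (subst (_∈ pair b) (sym x≡b⁺) (next∈pair b))
    via-b⁺⁺ : x ≡ next (next b) → x ∈ corner t
    via-b⁺⁺ x≡b⁺⁺ = subst (_∈ corner t) (sym x≡b⁺⁺) pos₀∈corner

  pos₀∈corner-last : ∀ {t} → toℕ t ≡ suc (suc k) → pos Fin.zero ∈ corner t
  pos₀∈corner-last {t} t≡last = subst (λ s → pos s ∈ corner t) (next-last t t≡last)
    (x∈p∪q⁺ {p = pair b} {q = extra t (next t)} (inj₂ (x∈p∪q⁺ {p = ⁅ pos t ⁆} {q = ⁅ pos (next t) ⁆} (inj₂ (x∈⁅x⁆ (pos (next t)))))))

module Paths where

  open import Data.Nat as ℕ using (_<_; z≤n)
  open import Data.Nat.Properties using (n<1+n; m<n⇒m<1+n)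
  open import Data.List using (_∷_)
  import Data.List.Membership.Propositional as List
  open import Data.List.Relation.Unary.Any using (here; there)
  open import Data.Sum using (inj₁; inj₂)
  open import Data.Product using (_×_; _,_; proj₁; proj₂; ∃-syntax)
  open import Data.Empty using (⊥-elim)
  open import Function using (_∘_)
  open import Relation.Binary.PropositionalEquality

  module _ {n : ℕ} {D : Subset n → Subset n → Set} where

    infixr 5 _++ₚ_
    _++ₚ_ : ∀ {u v w} → Path D u v → Path D v w → Path D u w
    [ _ ]          ++ₚ q = q
    (u ∷⟨ d ⟩ p) ++ₚ q = u ∷⟨ d ⟩ (p ++ₚ q)

    split-at : ∀ {u w v} (p : Path D u w) → v List.∈ verts p → Path D u v × Path D v w
    split-at [ u ]          (here refl) = [ u ] , [ u ]
    split-at (u ∷⟨ d ⟩ p) (here refl) = [ u ] , u ∷⟨ d ⟩ p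
    split-at (u ∷⟨ d ⟩ p) (there v∈p) with split-at p v∈p
    ... | p₁ , p₂ = u ∷⟨ d ⟩ p₁ , p₂

    reached-from-an-end : ∀ {a b v} (γ : JoinPath D a b) → v List.∈ joinVerts γ → Path D a v ⊎ Path D b v
    reached-from-an-end (inj₁ p) v∈γ = inj₁ (proj₁ (split-at p v∈γ))
    reached-from-an-end (inj₂ p) v∈γ = inj₂ (proj₁ (split-at p v∈γ))

    reaches-an-end : ∀ {a b v} (γ : JoinPath D a b) → v List.∈ joinVerts γ → Path D v a ⊎ Path D v b
    reaches-an-end (inj₁ p) v∈γ = inj₂ (proj₂ (split-at p v∈γ))
    reaches-an-end (inj₂ p) v∈γ = inj₁ (proj₂ (split-at p v∈γ))

    mutually-reachable⇒≡ : (∀ u v → D u v → Path D v u → ⊥) → ∀ {u v} → Path D u v → Path D v u → u ≡ v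
    mutually-reachable⇒≡ acyclic [ _ ]          _ = refl
    mutually-reachable⇒≡ acyclic (u ∷⟨ d ⟩ p) q = ⊥-elim (acyclic _ _ d (p ++ₚ q))

  Oriented : ∀ {n} → (Subset n → Subset n → Set) → (ℕ → Subset n) → Set
  Oriented D f = ∀ c → D (f c) (f (suc c)) ⊎ D (f (suc c)) (f c)

  SinkAtValleys : ∀ {n} → (Subset n → Subset n → Set) → Subset n → (ℕ → Subset n) → Set
  SinkAtValleys D s f = ∀ c → D (f c) (f (suc c)) → D (f (suc (suc c))) (f (suc c)) → f (suc c) ≡ s

  module _ {n : ℕ} {D : Subset n → Subset n → Set} {s : Subset n} where

    walk-right : ∀ k (f : ℕ → Subset n) → Oriented D f → SinkAtValleys D s f → D (f 0) (f 1) →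
                 Path D (f 1) (f (suc k)) ⊎ ∃[ j ] j < k × f (suc j) ≡ s × Path D (f 0) (f (suc j))
    walk-right zero    f _ _ _ = inj₁ [ f 1 ]
    walk-right (suc k) f oriented valley d with oriented 1
    ... | inj₂ d′ = inj₂ (0 , s≤s z≤n , valley 0 d d′ , f 0 ∷⟨ d ⟩ [ f 1 ])
    ... | inj₁ d′ with walk-right k (f ∘ suc) (oriented ∘ suc) (valley ∘ suc) d′
    ...   | inj₁ p                      = inj₁ (f 1 ∷⟨ d′ ⟩ p)
    ...   | inj₂ (j , j<k , f[j]≡s , p) = inj₂ (suc j , s≤s j<k , f[j]≡s , f 0 ∷⟨ d ⟩ p)

    walk-left : ∀ k (f : ℕ → Subset n) → Oriented D f → SinkAtValleys D s f → D (f (suc k)) (f k) →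
                Path D (f k) (f 0) ⊎ ∃[ j ] j < k × f (suc j) ≡ s × Path D (f (suc k)) (f (suc j))
    walk-left zero    f _ _ _ = inj₁ [ f 0 ]
    walk-left (suc k) f oriented valley d with oriented k
    ... | inj₁ d′ = inj₂ (k , n<1+n k , valley k d′ d , f (suc (suc k)) ∷⟨ d ⟩ [ f (suc k) ])
    ... | inj₂ d′ with walk-left k f oriented valley d′
    ...   | inj₁ p                      = inj₁ (f (suc k) ∷⟨ d′ ⟩ p)
    ...   | inj₂ (j , j<k , f[j]≡s , p) = inj₂ (j , m<n⇒m<1+n j<k , f[j]≡s , f (suc (suc k)) ∷⟨ d ⟩ p)

open Cyclic using (next)

module Polygon {n : ℕ} {D : Subset n → Subset n → Set}
               (acyclic : ∀ u v → D u v → Path D v u → ⊥)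
               {k : ℕ} (e : Fin (suc k) → Subset n) (s : Subset n)
               (oriented : ∀ t → D (e t) (e (next t)) ⊎ D (e (next t)) (e t))
               (valley : ∀ t → D (e t) (e (next t)) → D (e (next (next t))) (e (next t)) → e (next t) ≡ s)
               (e-injective : ∀ {t t′} → e t ≡ e t′ → t ≡ t′) where

  open import Data.Nat as ℕ using (_<_; z≤n)
  open import Data.Nat.Properties using (<-trans; <-irrefl; ≤-trans; m≤m+n; +-suc; +-monoʳ-<; m≤n⇒∃[o]m+o≡n)
  open import Data.Sum using (inj₁; inj₂)
  open import Data.Product using (_,_)
  open import Data.Empty using (⊥-elim)
  open import Relation.Nullary using (¬_)
  open import Relation.Binary.PropositionalEquality
  open Cyclic
  open Paths

  private
    from : Fin (suc k) → ℕ → Subset n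
    from t c = e (t ⊕ c)

    from-oriented : ∀ t → Oriented D (from t)
    from-oriented t c = oriented (t ⊕ c)

    from-valleys : ∀ t → SinkAtValleys D s (from t)
    from-valleys t c = valley (t ⊕ c)

  -- Follow the arcs out of e t; a walk all the way round the polygon would close a cycle.
  reaches-sink : ∀ t → Path D (e t) s
  reaches-sink t with oriented t
  ... | inj₁ t→t⁺ with walk-right k (from t) (from-oriented t) (from-valleys t) t→t⁺
  ...   | inj₁ p                  = ⊥-elim (acyclic _ _ t→t⁺ (subst (Path D _) (cong e (⊕-period t)) p))
  ...   | inj₂ (_ , _ , sink , p) = subst (Path D (e t)) sink p
  reaches-sink t | inj₂ t⁺→t with oriented (prev t)
  ... | inj₁ t⁻→t = subst (Path D (e t)) t≡s [ e t ]
    where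
    t≡s : e t ≡ s
    t≡s = trans (cong e (sym (next-prev t)))
                (valley (prev t) t⁻→t (subst (λ x → D (e (next x)) (e x)) (sym (next-prev t)) t⁺→t))
  ... | inj₂ t→t⁻ with walk-left k (from t) (from-oriented t) (from-valleys t) t→t⁻
  ...   | inj₁ p                  = ⊥-elim (acyclic _ _ t→t⁻ (subst (Path D _) (cong e (sym (next-prev t))) p))
  ...   | inj₂ (_ , _ , sink , p) = subst₂ (Path D) (cong e (next-prev t)) sink p

  -- Walk from the source p to t in both directions round the polygon.  If both walks stopped
  -- early, they would stop at two different positions holding the sink.
  source-reaches : ∀ p → (∀ t → ¬ D (e t) (e p)) → ∀ t → Path D (e p) (e t)
  source-reaches p no-arc-in t with ⊕-surjective p t
  ... | zero , _ , refl = [ e p ]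
  ... | suc d , d<m , refl with m≤n⇒∃[o]m+o≡n d<m
  ... | r , d+2+r≡k+1 with oriented p
  ... | inj₂ p⁺→p = ⊥-elim (no-arc-in (next p) p⁺→p)
  ... | inj₁ p→p⁺ with walk-right d (from p) (from-oriented p) (from-valleys p) p→p⁺
  ...   | inj₁ path = e p ∷⟨ p→p⁺ ⟩ path
  ...   | inj₂ (j , j<d , sinkʳ , _) = backward
    where
    d+r+2≡k+1 : suc d + suc r ≡ suc k
    d+r+2≡k+1 = trans (+-suc (suc d) r) d+2+r≡k+1
    around : t ⊕ suc r ≡ p
    around = trans (sym (⊕-+ p (suc d) (suc r))) (trans (cong (p ⊕_) d+r+2≡k+1) (⊕-period p))
    arc : D (e (t ⊕ suc r)) (e (t ⊕ r))
    arc with oriented (t ⊕ r)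
    ... | inj₁ d′ = ⊥-elim (no-arc-in (t ⊕ r) (subst (λ x → D (e (t ⊕ r)) (e x)) around d′))
    ... | inj₂ d′ = d′
    backward : Path D (e p) (e t)
    backward with walk-left r (from t) (from-oriented t) (from-valleys t) arc
    ... | inj₁ path = subst (λ x → Path D (e x) (e t)) around (e (t ⊕ suc r) ∷⟨ arc ⟩ path)
    ... | inj₂ (j′ , j′<r , sinkˡ , _) = ⊥-elim (<-irrefl j+1≡d+j′+2 j+1<d+j′+2)
      where
      j+1≡d+j′+2 : suc j ≡ suc d + suc j′
      j+1≡d+j′+2 = ⊕-injective p (<-trans (s≤s j<d) d<m)
        (subst (suc d + suc j′ <_) d+r+2≡k+1 (+-monoʳ-< (suc d) (s≤s j′<r)))
        (trans (e-injective (trans sinkʳ (sym sinkˡ))) (sym (⊕-+ p (suc d) (suc j′))))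
      j+1<d+j′+2 : suc j < suc d + suc j′
      j+1<d+j′+2 = ≤-trans (s≤s j<d) (m≤m+n (suc d) (suc j′))

module FacesOfAUSO {k : ℕ} {D : Subset (5 + k) → Subset (5 + k) → Set} (auso : IsAUSO (5 + k) D) where

  import Data.Fin as Fin
  open import Data.Fin.Properties using (toℕ-fromℕ)
  open import Data.Fin.Subset using (_⊆_)
  open import Data.Sum using (inj₁; inj₂; [_,_]′)
  open import Data.Product using (_×_; _,_; proj₁; proj₂; ∃-syntax)
  open import Function using (_∘_)
  open import Relation.Binary.PropositionalEquality
  open Cyclic
  open GaleEvenness using (pair; F≡pair)
  open Paths
  open IsAUSO auso

  module FacePolygon (b : Fin (5 + k)) (s : Subset (5 + k)) (s-sink : IsSinkOf D (pair b) s) where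

    open Face b

    -- Within the face, the only neighbours of a corner are the two adjacent corners, so a valley
    -- of the polygon is a sink of the face.
    valley : ∀ t → D (corner t) (corner (next t)) → D (corner (next (next t))) (corner (next t)) →
             corner (next t) ≡ s
    valley t t→t⁺ t⁺⁺→t⁺ = sinkUnique (pair b) _ s (corner-isVertex (next t) , pair⊆corner (next t) , no-arc-out) s-sink
      where
      no-arc-out : ∀ w → pair b ⊆ w → D (corner (next t)) w → ⊥
      no-arc-out w pair⊆w t⁺→w = [ to-t⁺⁺ , to-t ]′ (corner-neighbours {next t} {t′} (arc⇒adj _ _ t⁺→t′))
        where
        cover = corner-cover (proj₁ (proj₂ (arc⇒adj _ _ t⁺→w))) pair⊆w
        t′ = proj₁ cover
        t⁺→t′ : D (corner (next t)) (corner t′)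
        t⁺→t′ = subst (D (corner (next t))) (proj₂ cover) t⁺→w
        to-t⁺⁺ : t′ ≡ next (next t) → ⊥
        to-t⁺⁺ t′≡t⁺⁺ = antisym _ _ t⁺⁺→t⁺ (subst (λ x → D (corner (next t)) (corner x)) t′≡t⁺⁺ t⁺→t′)
        to-t : next t ≡ next t′ → ⊥
        to-t t⁺≡t′⁺ = antisym _ _ t→t⁺ (subst (λ x → D (corner (next t)) (corner x)) (sym (next-injective t⁺≡t′⁺)) t⁺→t′)

    open Polygon acyclic corner s (λ t → adj⇒arc _ _ (corner-adjacent t)) valley corner-injective

    face-reaches-sink : ∀ {x} → IsVertex x → pair b ⊆ x → Path D x s
    face-reaches-sink isV pair⊆x =
      let t , x≡corner = corner-cover isV pair⊆x in subst (λ y → Path D y s) (sym x≡corner) (reaches-sink t)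

    source-reaches-face : ∀ {q x} → IsSourceOf D (pair b) q → IsVertex x → pair b ⊆ x → Path D q x
    source-reaches-face (isV-q , pair⊆q , no-arc-in) isV pair⊆x =
      let p , q≡corner = corner-cover isV-q pair⊆q
          t , x≡corner = corner-cover isV pair⊆x
          no-arc-into-p : ∀ t′ → D (corner t′) (corner p) → ⊥
          no-arc-into-p t′ = no-arc-in (corner t′) (pair⊆corner t′) ∘ subst (D (corner t′)) (sym q≡corner)
      in subst₂ (Path D) (sym q≡corner) (sym x≡corner) (source-reaches p no-arc-into-p t)

  module Consecutive (q s : Fin (5 + k) → Subset (5 + k))
                     (sources : ∀ i → IsSourceOf D (F i) (q i)) (sinks : ∀ i → IsSinkOf D (F i) (s i))
                     (i : Fin (5 + k)) where

    open Face i using (corner; corner-isVertex; corner-injective; pair⊆corner; pair[b⁺]⊆corner; pos∈corner;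
                       pos₀∈corner-last)

    shared-vertex≡sink : ∀ {b c x} → IsVertex x → pair b ⊆ x → pair c ⊆ x → Path D (s c) (q b) → x ≡ s c
    shared-vertex≡sink {b} {c} isV pair[b]⊆x pair[c]⊆x sc→qb = mutually-reachable⇒≡ acyclic
      (FacePolygon.face-reaches-sink c (s c) (subst (λ T → IsSinkOf D T (s c)) (F≡pair c) (sinks c)) isV pair[c]⊆x)
      (sc→qb ++ₚ FacePolygon.source-reaches-face b (s b) (subst (λ T → IsSinkOf D T (s b)) (F≡pair b) (sinks b))
                   (subst (λ T → IsSourceOf D T (q b)) (F≡pair b) (sources b)) isV pair[b]⊆x)

    last : Fin (3 + k)
    last = Fin.fromℕ (2 + k)

    InBothCorners : Fin (5 + k) → Set
    InBothCorners c = pair c ⊆ corner Fin.zero × pair c ⊆ corner last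

    i-in-both : InBothCorners i
    i-in-both = pair⊆corner Fin.zero , pair⊆corner last

    i⁺-in-both : InBothCorners (sucMod i)
    i⁺-in-both = subst InBothCorners (next≡sucMod i)
      (pair[b⁺]⊆corner (pos∈corner Fin.zero) , pair[b⁺]⊆corner (pos₀∈corner-last (toℕ-fromℕ (2 + k))))

    no-path-sink-to-source : ∀ {b c} → InBothCorners b → InBothCorners c → Path D (s c) (q b) → ⊥
    no-path-sink-to-source (b⊆first , b⊆last) (c⊆first , c⊆last) sc→qb = first≢last (corner-injective
      (trans (shared-vertex≡sink (corner-isVertex Fin.zero) b⊆first c⊆first sc→qb)
             (sym (shared-vertex≡sink (corner-isVertex last) b⊆last c⊆last sc→qb))))
      where
      first≢last : Fin.zero ≢ last
      first≢last ()

    sink-end : ∀ {v} → Path D (s i) v ⊎ Path D (s (sucMod i)) v → ∃[ c ] InBothCorners c × Path D (s c) v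
    sink-end (inj₁ si→v)  = i , i-in-both , si→v
    sink-end (inj₂ si⁺→v) = sucMod i , i⁺-in-both , si⁺→v

    source-end : ∀ {v} → Path D v (q i) ⊎ Path D v (q (sucMod i)) → ∃[ b ] InBothCorners b × Path D v (q b)
    source-end (inj₁ v→qi)  = i , i-in-both , v→qi
    source-end (inj₂ v→qi⁺) = sucMod i , i⁺-in-both , v→qi⁺

open import Data.List.Membership.Propositional using (_∈_)
open import Data.Product using (_,_)
open Paths using (reached-from-an-end; reaches-an-end; _++ₚ_)

proposition2p8 : (n : ℕ) → 5 ≤ n → (D : Subset n → Subset n → Set) → IsAUSO n D →
    (q s : Fin n → Subset n) →
    (∀ i → IsSourceOf D (F i) (q i)) → (∀ i → IsSinkOf D (F i) (s i)) →
    (i : Fin n) →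
    (γq : JoinPath D (q i) (q (sucMod i))) →
    (γs : JoinPath D (s i) (s (sucMod i))) →
    ∀ v → v ∈ joinVerts γq → v ∈ joinVerts γs → ⊥
proposition2p8 (suc (suc (suc (suc (suc k))))) _ D auso q s sources sinks i γq γs v v∈γq v∈γs =
  let open FacesOfAUSO.Consecutive auso q s sources sinks i
      c , c-in-both , sc→v = sink-end (reached-from-an-end γs v∈γs)
      b , b-in-both , v→qb = source-end (reaches-an-end γq v∈γq)
  in no-path-sink-to-source b-in-both c-in-both (sc→v ++ₚ v→qb)
proposition2p8 (suc zero)                   (s≤s ())
proposition2p8 (suc (suc zero))             (s≤s (s≤s ()))
proposition2p8 (suc (suc (suc zero)))       (s≤s (s≤s (s≤s ())))
proposition2p8 (suc (suc (suc (suc zero)))) (s≤s (s≤s (s≤s (s≤s ()))))
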